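{- Let $\overline{R}_1\overline{R}_2\cdots$ be an infinite sequence in $\{\overline{U},\overline{V}\}$ in which both $\overline{U}$ and $\overline{V}$ occur infinitely many times. Let $(\alpha_0,\beta_0)=(a,b)$ and $(\alpha_{n+1},\beta_{n+1})=\overline{R}_{n+1}(\alpha_n,\beta_n)$ for $n\ge0$. Then the sequences of marked finite words $\{\beta_i\,\vert\,\alpha_i\}_{i\in\mathbb{N}}$ and $\{\alpha_i^T\,\vert\,\beta_i^T\}_{i\in\mathbb{N}}$ converge to bi-infinite words, and each of these two limit words $\underline{\omega}$ satisfies $l(\underline{\omega})=m(\underline{\omega})=3$.
   Context: Words over $\{a,b\}$ are identified with words over $\{1,2\}$ via $a\mapsto22$, $b\mapsto11$; $w^T$ denotes the reversal of a finite word $w$. $\overline{U}(\alpha,\beta)=(\alpha\beta,\beta)$, $\overline{V}(\alpha,\beta)=(\alpha,\alpha\beta)$. For $\underline{x}\in\{1,2\}^{\mathbb{Z}}$: $\lambda(\underline{x})=[x_0;x_1,\dots]+[0;x_{ -1},x_{ -2},\dots]$, $(\sigma\underline{x})_i=x_{i-1}$, $m(\underline{x})=\sup_{n\in\mathbb{Z}}\lambda(\sigma^n\underline{x})$, $l(\underline{x})=\limsup_{n\to\infty}\lambda(\sigma^n\underline{x})$. A sequence of finite words with a marked position $w_i=w_i^1\,\vert\,w_i^2$ converges to the bi-infinite word $\underline{\omega}=(x_j)_{j\in\mathbb{Z}}$ (with $x_0$ the first letter right of the mark) if every prefix of $x_0x_1x_2\cdots$ is a prefix of $w_i^2$ for all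 but finitely many $i$, and every prefix of $x_{ -1}x_{ -2}\cdots$ is a prefix of $(w_i^1)^T$ for all but finitely many $i$. -}

module Defs where

open import Data.Nat using (ℕ; zero; suc; _*_) renaming (_+_ to _+ℕ_; _≤_ to _≤ℕ_)
open import Data.Integer using (ℤ; +_; -[1+_]) renaming (_-_ to _-ℤ_)
open import Data.Rational.Unnormalised using (ℚᵘ; mkℚᵘ; 0ℚᵘ; _+_; _-_; _≤_; _<_)
open import Data.List using (List; []; _∷_; _++_; reverse; map; concatMap; upTo)
open import Data.Product using (_×_; _,_; proj₁; proj₂; ∃)
open import Relation.Binary.PropositionalEquality using (_≡_)

data AB : Set where
  a b : AB

data Digit : Set where
  one two : Digit

letter : AB → List Digit
letter a = two ∷ two ∷ []
letter b = one ∷ one ∷ []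

toDigits : List AB → List Digit
toDigits = concatMap letter

data Move : Set where
  U V : Move

apply : Move → List AB × List AB → List AB × List AB
apply U (α , β) = (α ++ β , β)
apply V (α , β) = (α , α ++ β)

-- R n is the move R̄_{n+1}
pairs : (ℕ → Move) → ℕ → List AB × List AB
pairs R zero    = (a ∷ [] , b ∷ [])
pairs R (suc n) = apply (R n) (pairs R n)

InfinitelyOften : (ℕ → Move) → Move → Set
InfinitelyOften R m = ∀ N → ∃ λ n → N ≤ℕ n × R n ≡ m

BiWord : Set
BiWord = ℤ → Digit

-- w¹ | w² is represented as the pair (w¹ , w²)
Marked : Set
Marked = List Digit × List Digit

IsPrefix : List Digit → List Digit → Set
IsPrefix p w = ∃ λ s → p ++ s ≡ w

rightPrefix : BiWord → ℕ → List Digit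
rightPrefix ω k = map (λ j → ω (+ j)) (upTo k)

leftPrefix : BiWord → ℕ → List Digit
leftPrefix ω k = map (λ j → ω -[1+ j ]) (upTo k)

ConvergesTo : (ℕ → Marked) → BiWord → Set
ConvergesTo w ω = ∀ k → ∃ λ I → ∀ i → I ≤ℕ i →
  IsPrefix (rightPrefix ω k) (proj₂ (w i)) ×
  IsPrefix (leftPrefix ω k) (reverse (proj₁ (w i)))

-- Finite continued fractions with partial quotients in {1,2}.
-- A pair (P , Q) represents the positive rational (P+1)/(Q+1).

val : Digit → ℕ
val one = 1
val two = 2

-- [f 0; f 1, …, f k]
cf : (ℕ → Digit) → ℕ → ℕ × ℕ
cf f zero with f 0
... | one = (0 , 0)
... | two = (1 , 0)
cf f (suc k) with cf (λ j → f (suc j)) k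
... | (P , Q) = (val (f 0) * suc P +ℕ Q , P)

toℚ : ℕ × ℕ → ℚᵘ
toℚ (P , Q) = mkℚᵘ (+ suc P) Q

recipℚ : ℕ × ℕ → ℚᵘ
recipℚ (P , Q) = mkℚᵘ (+ suc Q) P

-- k-th approximant of λ(y) = [y₀; y₁, …] + [0; y₋₁, y₋₂, …]:
--   [y₀; y₁, …, y_k] + [0; y₋₁, …, y₋₍ₖ₊₁₎]
lamApprox : BiWord → ℕ → ℚᵘ
lamApprox y k = toℚ (cf (λ j → y (+ j)) k) + recipℚ (cf (λ j → y -[1+ j ]) k)

LimLe : (ℕ → ℚᵘ) → ℚᵘ → Set
LimLe s c = ∀ ε → 0ℚᵘ < ε → ∃ λ K → ∀ k → K ≤ℕ k → s k ≤ c + ε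

LimGe : (ℕ → ℚᵘ) → ℚᵘ → Set
LimGe s c = ∀ ε → 0ℚᵘ < ε → ∃ λ K → ∀ k → K ≤ℕ k → c - ε ≤ s k

LamLe : BiWord → ℚᵘ → Set
LamLe y c = LimLe (lamApprox y) c

LamGe : BiWord → ℚᵘ → Set
LamGe y c = LimGe (lamApprox y) c

shift : ℤ → BiWord → BiWord
shift n x i = x (i -ℤ n)

three : ℚᵘ
three = mkℚᵘ (+ 3) 0

-- m(x) = sup_{n ∈ ℤ} λ(σⁿ x) = 3
MarkovValueIs3 : BiWord → Set
MarkovValueIs3 x =
  (∀ n → LamLe (shift n x) three) ×
  (∀ ε → 0ℚᵘ < ε → ∃ λ n → LamGe (shift n x) (three - ε))

-- l(x) = limsup_{n → ∞} λ(σⁿ x) = 3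
LagrangeValueIs3 : BiWord → Set
LagrangeValueIs3 x =
  (∀ ε → 0ℚᵘ < ε → ∃ λ N → ∀ n → N ≤ℕ n → LamLe (shift (+ n) x) (three + ε)) ×
  (∀ ε → 0ℚᵘ < ε → ∀ N → ∃ λ n → N ≤ℕ n × LamGe (shift (+ n) x) (three - ε))

seqβα : (ℕ → Move) → ℕ → Marked
seqβα R i = (toDigits (proj₂ (pairs R i)) , toDigits (proj₁ (pairs R i)))

seqαTβT : (ℕ → Move) → ℕ → Marked
seqαTβT R i = (toDigits (reverse (proj₁ (pairs R i))) , toDigits (reverse (proj₂ (pairs R i))))

ConvergesWithLM3 : (ℕ → Marked) → Set
ConvergesWithLM3 w =
  (∃ λ ω → ConvergesTo w ω) ×
  (∀ ω → ConvergesTo w ω → LagrangeValueIs3 ω × MarkovValueIs3 ω)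

-- βₙαₙ is the image of ba under the substitutions a ↦ ab, b ↦ b (for Ū) and a ↦ a, b ↦ ab
-- (for V̄), and both preserve the property that at each factor ab the reversed left context is
-- lexicographically below the right one, and symmetrically at each ba.  After coding a ↦ 22,
-- b ↦ 11, a window of a limit word either has value at most 3 outright, or (there being no
-- isolated digits) is centred at 11|22 or 2|211; there its value is 3 plus a multiple of the
-- difference of the continued fractions of its two flanks, which that property makes ≤ 0.
-- So λ ≤ 3 everywhere.  Conversely αₙ = aA and βₙ = Bb with AB a palindrome, so the flanks of
-- the centre ba of βₙαₙ agree on min(|A|, |B|) letters; continued fractions agreeing on m
-- digits differ by at most 1/(m − 1), so λ at the mark tends to 3.  Copies of this centre at
-- fixed but arbitrarily large distances from the mark give the same for the limsup.

module Submission where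

open import Defs
open import Data.Nat using (ℕ; zero; suc; _+_; _*_; _∸_; _≤_; z≤n; s≤s; pred)
open import Data.Nat.Properties
open import Data.Nat.Solver using (module +-*-Solver)
open import Data.Integer as ℤ using (ℤ; +_; -[1+_]; +≤+)
import Data.Integer.Properties as ℤP
import Data.Integer.Solver as ℤ-Solver
open import Data.Rational.Unnormalised as ℚ using (ℚᵘ; mkℚᵘ; *≤*; ↥_; ↧_; 0ℚᵘ)
import Data.Rational.Unnormalised.Properties as ℚP
open import Data.List using (List; []; _∷_; _++_; [_]; length; reverse; applyUpTo; map; upTo; initLast; _∷ʳ′_)
open import Data.List.Properties
  using (++-assoc; ++-identityʳ; ∷-injective; unfold-reverse; reverse-++; reverse-involutive;
         length-++; length-reverse; length-applyUpTo; length-map; length-upTo; applyUpTo-∷ʳ; map-upTo; concatMap-++;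
         ∷-injectiveʳ; ∷ʳ-injectiveˡ; map-++; reverse-map)
open import Data.Product using (_×_; _,_; proj₁; proj₂; ∃)
open import Data.Sum using (_⊎_; inj₁; inj₂)
open import Data.Empty using (⊥-elim)
open import Relation.Nullary using (¬_)
open import Relation.Binary.PropositionalEquality hiding ([_])

-- num X / den X is the continued fraction [x₀; x₁, …, xₖ] of X = x₀ x₁ … xₖ.
mutual
  num : List Digit → ℕ
  num []      = 1
  num (d ∷ X) = val d * num X + den X

  den : List Digit → ℕ
  den []      = 0
  den (d ∷ X) = num X

n≤val*n : ∀ d n → n ≤ val d * n
n≤val*n one n = m≤m+n n 0
n≤val*n two n = m≤m+n n (n + 0)

num≤num-∷ : ∀ d X → num X ≤ num (d ∷ X)
num≤num-∷ d X = ≤-trans (n≤val*n d (num X)) (m≤m+n _ _)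

den≤num : ∀ X → den X ≤ num X
den≤num []      = z≤n
den≤num (d ∷ X) = num≤num-∷ d X

num-pos : ∀ X → 1 ≤ num X
num-pos []      = s≤s z≤n
num-pos (d ∷ X) = ≤-trans (num-pos X) (num≤num-∷ d X)

den+num≤num-∷ : ∀ d X → den X + num X ≤ num (d ∷ X)
den+num≤num-∷ d X = subst (_≤ num (d ∷ X)) (+-comm (num X) (den X)) (+-monoˡ-≤ (den X) (n≤val*n d (num X)))

-- excess X Y / (den X * den Y) is the positive part of [X] − [Y].
excess : List Digit → List Digit → ℕ
excess X Y = num X * den Y ∸ num Y * den X

excess-∷ : ∀ d X Y → excess (d ∷ X) (d ∷ Y) ≡ excess Y X
excess-∷ d X Y = begin
  (v * num X + den X) * num Y ∸ (v * num Y + den Y) * num X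
    ≡⟨ cong₂ _∸_ (expand v (num X) (den X) (num Y)) (expand v (num Y) (den Y) (num X)) ⟩
  (v * num X * num Y + num Y * den X) ∸ (v * num Y * num X + num X * den Y)
    ≡⟨ cong (λ z → (v * num X * num Y + num Y * den X) ∸ (z + num X * den Y)) (swap v (num Y) (num X)) ⟩
  (v * num X * num Y + num Y * den X) ∸ (v * num X * num Y + num X * den Y)
    ≡⟨ [m+n]∸[m+o]≡n∸o (v * num X * num Y) (num Y * den X) (num X * den Y) ⟩
  num Y * den X ∸ num X * den Y ∎
  where
  open +-*-Solver
  open ≡-Reasoning
  v = val d
  expand : ∀ v x y z → (v * x + y) * z ≡ v * x * z + z * y
  expand = solve 4 (λ v x y z → (v :* x :+ y) :* z := v :* x :* z :+ z :* y) refl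
  swap : ∀ v x y → v * x * y ≡ v * y * x
  swap = solve 3 (λ v x y → v :* x :* y := v :* y :* x) refl

-- Agreement of X and Y on their first n digits gives [X] − [Y] ≤ 1/(n − 1).  The
-- second component is the stronger bound on the numerators that carries the induction.
ExcessBound : ℕ → List Digit → List Digit → Set
ExcessBound n X Y = ((n ∸ 1) * excess X Y ≤ den X * den Y) × (n * excess X Y ≤ num X * num Y)

excessBound-∷ : ∀ d X Y n → ExcessBound n Y X → ExcessBound (suc n) (d ∷ X) (d ∷ Y)
excessBound-∷ d X Y n (_ , bound) rewrite excess-∷ d X Y =
    subst (n * excess Y X ≤_) (*-comm (num Y) (num X)) bound
  , (begin
      excess Y X + n * excess Y X      ≤⟨ +-mono-≤ (m∸n≤m (num Y * den X) (num X * den Y)) bound ⟩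
      num Y * den X + num Y * num X    ≡⟨ sym (*-distribˡ-+ (num Y) (den X) (num X)) ⟩
      num Y * (den X + num X)          ≤⟨ *-mono-≤ (num≤num-∷ d Y) (den+num≤num-∷ d X) ⟩
      num (d ∷ Y) * num (d ∷ X)        ≡⟨ *-comm (num (d ∷ Y)) (num (d ∷ X)) ⟩
      num (d ∷ X) * num (d ∷ Y)        ∎)
  where open ≤-Reasoning

excessBound-0 : ∀ X Y → ExcessBound 0 X Y
excessBound-0 X Y = z≤n , z≤n

excessBound-++ : ∀ c X Y → ExcessBound (length c) (c ++ X) (c ++ Y)
excessBound-++ []      X Y = excessBound-0 X Y
excessBound-++ (d ∷ c) X Y = excessBound-∷ d (c ++ X) (c ++ Y) (length c) (excessBound-++ c Y X)

excess-1-2 : ∀ X Y → excess (one ∷ X) (two ∷ Y) ≡ 0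
excess-1-2 X Y = m≤n⇒m∸n≡0 (begin
    (1 * num X + den X) * num Y    ≤⟨ *-monoˡ-≤ (num Y) (+-monoʳ-≤ (1 * num X) (den≤num X)) ⟩
    (1 * num X + num X) * num Y    ≡⟨ rearrange (num X) (num Y) ⟩
    num X * (2 * num Y)            ≤⟨ *-monoʳ-≤ (num X) (m≤m+n (2 * num Y) (den Y)) ⟩
    num X * (2 * num Y + den Y)    ≡⟨ *-comm (num X) _ ⟩
    (2 * num Y + den Y) * num X    ∎)
  where
  open +-*-Solver
  open ≤-Reasoning
  rearrange : ∀ x y → (1 * x + x) * y ≡ x * (2 * y)
  rearrange = solve 2 (λ x y → (con 1 :* x :+ x) :* y := x :* (con 2 :* y)) refl

excessBound-excess≡0 : ∀ n X Y → excess X Y ≡ 0 → ExcessBound n X Y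
excessBound-excess≡0 n X Y e rewrite e | *-zeroʳ (n ∸ 1) | *-zeroʳ n = z≤n , z≤n

excessBound-≤0 : ∀ {n} X Y → n ≤ 0 → ExcessBound n X Y
excessBound-≤0 X Y z≤n = excessBound-0 X Y

-- X ≤cf Y: one of X, Y extends the other, or they first differ at an even position, where
-- X has 1 and Y has 2, so that [X] < [Y].  After an odd number of common digits (≤cf′) only
-- the first alternative is needed.
mutual
  data _≤cf_ : List Digit → List Digit → Set where
    []≤ : ∀ {Y} → [] ≤cf Y
    ≤[] : ∀ {X} → X ≤cf []
    1<2 : ∀ {X Y} → (one ∷ X) ≤cf (two ∷ Y)
    ∷≤  : ∀ {d X Y} → X ≤cf′ Y → (d ∷ X) ≤cf (d ∷ Y)

  data _≤cf′_ : List Digit → List Digit → Set where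
    []≤′ : ∀ {Y} → [] ≤cf′ Y
    ≤[]′ : ∀ {X} → X ≤cf′ []
    ∷≤′  : ∀ {d X Y} → X ≤cf Y → (d ∷ X) ≤cf′ (d ∷ Y)

mutual
  ≤cf⇒excessBound : ∀ {X Y} n → X ≤cf Y → n ≤ length X → n ≤ length Y → ExcessBound n X Y
  ≤cf⇒excessBound {X} {Y} n []≤ nX nY                     = excessBound-≤0 X Y nX
  ≤cf⇒excessBound {X} {Y} n ≤[] nX nY                     = excessBound-≤0 X Y nY
  ≤cf⇒excessBound n (1<2 {X} {Y}) nX nY                   = excessBound-excess≡0 n (one ∷ X) (two ∷ Y) (excess-1-2 X Y)
  ≤cf⇒excessBound {X} {Y} zero (∷≤ X≤Y) nX nY             = excessBound-0 X Y
  ≤cf⇒excessBound (suc n) (∷≤ {d} {X} {Y} X≤Y) (s≤s nX) (s≤s nY) =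
    excessBound-∷ d X Y n (≤cf′⇒excessBound n X≤Y nX nY)

  ≤cf′⇒excessBound : ∀ {X Y} n → X ≤cf′ Y → n ≤ length X → n ≤ length Y → ExcessBound n Y X
  ≤cf′⇒excessBound {X} {Y} n []≤′ nX nY                   = excessBound-≤0 Y X nX
  ≤cf′⇒excessBound {X} {Y} n ≤[]′ nX nY                   = excessBound-≤0 Y X nY
  ≤cf′⇒excessBound {X} {Y} zero (∷≤′ X≤Y) nX nY           = excessBound-0 Y X
  ≤cf′⇒excessBound (suc n) (∷≤′ {d} {X} {Y} X≤Y) (s≤s nX) (s≤s nY) =
    excessBound-∷ d Y X n (≤cf⇒excessBound n X≤Y nX nY)

mutual
  ≤cf-prefix : ∀ {X X′ Y Y′} → (X ++ X′) ≤cf (Y ++ Y′) → X ≤cf Y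
  ≤cf-prefix {[]}                  _          = []≤
  ≤cf-prefix {_ ∷ _} {Y = []}      _          = ≤[]
  ≤cf-prefix {_ ∷ _} {Y = _ ∷ _}   1<2        = 1<2
  ≤cf-prefix {_ ∷ _} {Y = _ ∷ _}   (∷≤ X≤Y)   = ∷≤ (≤cf′-prefix X≤Y)

  ≤cf′-prefix : ∀ {X X′ Y Y′} → (X ++ X′) ≤cf′ (Y ++ Y′) → X ≤cf′ Y
  ≤cf′-prefix {[]}                 _          = []≤′
  ≤cf′-prefix {_ ∷ _} {Y = []}     _          = ≤[]′
  ≤cf′-prefix {_ ∷ _} {Y = _ ∷ _}  (∷≤′ X≤Y)  = ∷≤′ (≤cf-prefix X≤Y)

-- A window (R , L) consists of a right part y₀ y₁ … and a left part y₋₁ y₋₂ …; its value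
-- [y₀; y₁, …] + [0; y₋₁, y₋₂, …] is windowNum R L / windowDen R L.
windowNum : List Digit → List Digit → ℕ
windowNum R L = num R * num L + den L * den R

windowDen : List Digit → List Digit → ℕ
windowDen R L = den R * num L

Value≤3 : List Digit → List Digit → Set
Value≤3 R L = windowNum R L ≤ 3 * windowDen R L

Value≤3+ : ℕ → List Digit → List Digit → Set
Value≤3+ n R L = suc n * windowNum R L ≤ suc n * (3 * windowDen R L) + windowDen R L

Value≥3- : ℕ → List Digit → List Digit → Set
Value≥3- n R L = suc n * (3 * windowDen R L) ≤ suc n * windowNum R L + windowDen R L

value≤3⇒value≤3+ : ∀ n R L → Value≤3 R L → Value≤3+ n R L
value≤3⇒value≤3+ n R L le = ≤-trans (*-monoʳ-≤ (suc n) le) (m≤m+n _ (windowDen R L))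

value≤3-1∷ : ∀ R L → Value≤3 (one ∷ R) L
value≤3-1∷ R L = begin
    (1 * num R + den R) * num L + den L * num R
      ≤⟨ +-mono-≤ (*-monoˡ-≤ (num L) (+-monoʳ-≤ (1 * num R) (den≤num R))) (*-monoˡ-≤ (num R) (den≤num L)) ⟩
    (1 * num R + num R) * num L + num L * num R
      ≡⟨ rearrange (num R) (num L) ⟩
    3 * (num R * num L) ∎
  where
  open +-*-Solver
  open ≤-Reasoning
  rearrange : ∀ x y → (1 * x + x) * y + y * x ≡ 3 * (x * y)
  rearrange = solve 2 (λ x y → (con 1 :* x :+ x) :* y :+ y :* x := con 3 :* (x :* y)) refl

value≤3-22|2 : ∀ R L → Value≤3 (two ∷ two ∷ R) (two ∷ L)
value≤3-22|2 R L = subst (windowNum (two ∷ two ∷ R) (two ∷ L) ≤_)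
    (expand (num R) (den R) (num L) (den L)) (m≤m+n _ _)
  where
  open +-*-Solver
  expand : ∀ p q p′ q′ →
    (2 * (2 * p + q) + p) * (2 * p′ + q′) + p′ * (2 * p + q) + (p * q′ + q * p′ + q * q′)
      ≡ 3 * ((2 * p + q) * (2 * p′ + q′))
  expand = solve 4 (λ p q p′ q′ →
    (con 2 :* (con 2 :* p :+ q) :+ p) :* (con 2 :* p′ :+ q′) :+ p′ :* (con 2 :* p :+ q)
      :+ (p :* q′ :+ q :* p′ :+ q :* q′)
      := con 3 :* ((con 2 :* p :+ q) :* (con 2 :* p′ :+ q′))) refl

-- The value of such a window exceeds 3 by ([X] − [Y]) · den X · den Y / windowDen R L.
record NearThree (R L X Y : List Digit) : Set where
  field
    balance       : windowNum R L + num Y * den X ≡ 3 * windowDen R L + num X * den Y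
    den*den≤      : den X * den Y ≤ windowDen R L

den≤num-∷ : ∀ d X → den X ≤ num (d ∷ X)
den≤num-∷ d X = ≤-trans (den≤num X) (num≤num-∷ d X)

den≤num-11∷ : ∀ X → den X ≤ num (one ∷ one ∷ X)
den≤num-11∷ X = ≤-trans (den≤num-∷ one X) (num≤num-∷ one (one ∷ X))

nearThree-22|11 : ∀ X Y → NearThree (two ∷ two ∷ X) (one ∷ one ∷ Y) X Y
nearThree-22|11 X Y = record
  { balance  = identity (num X) (den X) (num Y) (den Y)
  ; den*den≤ = *-mono-≤ (den≤num-∷ two X) (den≤num-11∷ Y)
  }
  where
  open +-*-Solver
  identity : ∀ p q p′ q′ →
    (2 * (2 * p + q) + p) * (1 * (1 * p′ + q′) + p′) + (1 * p′ + q′) * (2 * p + q) + p′ * q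
      ≡ 3 * ((2 * p + q) * (1 * (1 * p′ + q′) + p′)) + p * q′
  identity = solve 4 (λ p q p′ q′ →
    (con 2 :* (con 2 :* p :+ q) :+ p) :* (con 1 :* (con 1 :* p′ :+ q′) :+ p′)
      :+ (con 1 :* p′ :+ q′) :* (con 2 :* p :+ q) :+ p′ :* q
      := con 3 :* ((con 2 :* p :+ q) :* (con 1 :* (con 1 :* p′ :+ q′) :+ p′)) :+ p :* q′) refl

nearThree-211|2 : ∀ X Y → NearThree (two ∷ one ∷ one ∷ Y) (two ∷ X) X Y
nearThree-211|2 X Y = record
  { balance  = identity (num X) (den X) (num Y) (den Y)
  ; den*den≤ = subst (_≤ windowDen (two ∷ one ∷ one ∷ Y) (two ∷ X)) (*-comm (den Y) (den X))
                     (*-mono-≤ (den≤num-11∷ Y) (den≤num-∷ two X))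
  }
  where
  open +-*-Solver
  identity : ∀ p q p′ q′ →
    (2 * (1 * (1 * p′ + q′) + p′) + (1 * p′ + q′)) * (2 * p + q) + p * (1 * (1 * p′ + q′) + p′) + p′ * q
      ≡ 3 * ((1 * (1 * p′ + q′) + p′) * (2 * p + q)) + p * q′
  identity = solve 4 (λ p q p′ q′ →
    (con 2 :* (con 1 :* (con 1 :* p′ :+ q′) :+ p′) :+ (con 1 :* p′ :+ q′)) :* (con 2 :* p :+ q)
      :+ p :* (con 1 :* (con 1 :* p′ :+ q′) :+ p′) :+ p′ :* q
      := con 3 :* ((con 1 :* (con 1 :* p′ :+ q′) :+ p′) :* (con 2 :* p :+ q)) :+ p :* q′) refl

*-≤-balanced : ∀ N S T x y B → S + y ≡ T + x → N * (x ∸ y) ≤ B → N * S ≤ N * T + B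
*-≤-balanced N S T x y B balance bound = +-cancelʳ-≤ (N * y) (N * S) (N * T + B) (begin
    N * S + N * y                   ≡⟨ sym (*-distribˡ-+ N S y) ⟩
    N * (S + y)                     ≡⟨ cong (N *_) balance ⟩
    N * (T + x)                     ≤⟨ *-monoʳ-≤ N (+-monoʳ-≤ T (m≤n+m∸n x y)) ⟩
    N * (T + (y + (x ∸ y)))         ≡⟨ distribute N T y (x ∸ y) ⟩
    N * T + N * (x ∸ y) + N * y     ≤⟨ +-monoˡ-≤ (N * y) (+-monoʳ-≤ (N * T) bound) ⟩
    N * T + B + N * y               ∎)
  where
  open +-*-Solver
  open ≤-Reasoning
  distribute : ∀ N T y z → N * (T + (y + z)) ≡ N * T + N * z + N * y
  distribute = solve 4 (λ N T y z → N :* (T :+ (y :+ z)) := N :* T :+ N :* z :+ N :* y) refl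

module _ {R L X Y} (near : NearThree R L X Y) where
  open NearThree near

  value≤3+ : ∀ n m → ExcessBound m X Y → suc n ≤ m ∸ 1 → Value≤3+ n R L
  value≤3+ n m (bound , _) n<m =
    *-≤-balanced (suc n) (windowNum R L) (3 * windowDen R L) (num X * den Y) (num Y * den X)
      (windowDen R L) balance (≤-trans (*-monoˡ-≤ (excess X Y) n<m) (≤-trans bound den*den≤))

  value≥3- : ∀ n m → ExcessBound m Y X → suc n ≤ m ∸ 1 → Value≥3- n R L
  value≥3- n m (bound , _) n<m =
    *-≤-balanced (suc n) (3 * windowDen R L) (windowNum R L) (num Y * den X) (num X * den Y)
      (windowDen R L) (sym balance)
      (≤-trans (*-monoˡ-≤ (excess Y X) n<m)
        (≤-trans bound (subst (_≤ windowDen R L) (*-comm (den X) (den Y)) den*den≤)))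

1/[1+_] : ℕ → ℚᵘ
1/[1+ n ] = mkℚᵘ (+ 1) n

cfOf : List Digit → ℕ × ℕ
cfOf X = pred (num X) , pred (den X)

suc-pred-pos : ∀ {n} → 1 ≤ n → suc (pred n) ≡ n
suc-pred-pos (s≤s _) = refl

+-pred : ∀ m {n} → 1 ≤ n → m + pred n ≡ pred (m + n)
+-pred m {suc n} _ = sym (cong pred (+-suc m n))

cf≡cfOf : ∀ f k → cf f k ≡ cfOf (applyUpTo f (suc k))
cf≡cfOf f zero with f 0
... | one = refl
... | two = refl
cf≡cfOf f (suc k)
  rewrite cf≡cfOf (λ j → f (suc j)) k | suc-pred-pos (num-pos (applyUpTo (λ j → f (suc j)) (suc k))) =
  cong (_, pred (num L)) (+-pred (val (f 0) * num L) (num-pos (applyUpTo (λ j → f (suc (suc j))) k)))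
  where L = applyUpTo (λ j → f (suc j)) (suc k)

windowValue : List Digit → List Digit → ℚᵘ
windowValue R L = toℚ (cfOf R) ℚ.+ recipℚ (cfOf L)

rightWindow leftWindow : BiWord → ℕ → List Digit
rightWindow y k = applyUpTo (λ j → y (+ j)) (suc k)
leftWindow  y k = applyUpTo (λ j → y -[1+ j ]) (suc k)

length-rightWindow : ∀ y k → length (rightWindow y k) ≡ suc k
length-rightWindow y k = length-applyUpTo (λ j → y (+ j)) (suc k)

length-leftWindow : ∀ y k → length (leftWindow y k) ≡ suc k
length-leftWindow y k = length-applyUpTo (λ j → y -[1+ j ]) (suc k)

lamApprox≡windowValue : ∀ y k → lamApprox y k ≡ windowValue (rightWindow y k) (leftWindow y k)
lamApprox≡windowValue y k rewrite cf≡cfOf (λ j → y (+ j)) k | cf≡cfOf (λ j → y -[1+ j ]) k = refl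

≤-by-cross : ∀ {p q : ℚᵘ} m n → ↥ p ℤ.* ↧ q ≡ + m → ↥ q ℤ.* ↧ p ≡ + n → m ≤ n → p ℚ.≤ q
≤-by-cross m n e₁ e₂ m≤n = *≤* (subst₂ ℤ._≤_ (sym e₁) (sym e₂) (+≤+ m≤n))

+*+ : ∀ {i j} m n → i ≡ + m → j ≡ + n → i ℤ.* j ≡ + (m * n)
+*+ m n refl refl = sym (ℤP.pos-* m n)

↥-+ : ∀ x₁ y₁ x₂ y₂ → ↥ (mkℚᵘ (+ x₁) y₁ ℚ.+ mkℚᵘ (+ x₂) y₂) ≡ + (x₁ * suc y₂ + x₂ * suc y₁)
↥-+ x₁ y₁ x₂ y₂ = trans (cong₂ ℤ._+_ (sym (ℤP.pos-* x₁ (suc y₂))) (sym (ℤP.pos-* x₂ (suc y₁))))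
                       (sym (ℤP.pos-+ (x₁ * suc y₂) (x₂ * suc y₁)))

sum≤3+ : ∀ x₁ y₁ x₂ y₂ n →
  suc n * (x₁ * suc y₂ + x₂ * suc y₁) ≤ suc n * (3 * (suc y₁ * suc y₂)) + suc y₁ * suc y₂ →
  mkℚᵘ (+ x₁) y₁ ℚ.+ mkℚᵘ (+ x₂) y₂ ℚ.≤ three ℚ.+ 1/[1+ n ]
sum≤3+ x₁ y₁ x₂ y₂ n le =
  ≤-by-cross _ _ (+*+ _ (1 * suc n) (↥-+ x₁ y₁ x₂ y₂) refl) (+*+ _ (suc y₁ * suc y₂) (↥-+ 3 0 1 n) refl)
    (subst₂ _≤_ (lhs (x₁ * suc y₂ + x₂ * suc y₁) (suc n)) (rhs (suc y₁ * suc y₂) (suc n)) le)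
  where
  open +-*-Solver
  lhs : ∀ A N → N * A ≡ A * (1 * N)
  lhs = solve 2 (λ A N → N :* A := A :* (con 1 :* N)) refl
  rhs : ∀ B N → N * (3 * B) + B ≡ (3 * N + 1 * 1) * B
  rhs = solve 2 (λ B N → N :* (con 3 :* B) :+ B := (con 3 :* N :+ con 1 :* con 1) :* B) refl

3≤sum+ : ∀ x₁ y₁ x₂ y₂ n →
  suc n * (3 * (suc y₁ * suc y₂)) ≤ suc n * (x₁ * suc y₂ + x₂ * suc y₁) + suc y₁ * suc y₂ →
  three ℚ.≤ (mkℚᵘ (+ x₁) y₁ ℚ.+ mkℚᵘ (+ x₂) y₂) ℚ.+ 1/[1+ n ]
3≤sum+ x₁ y₁ x₂ y₂ n le =
  ≤-by-cross _ _ (+*+ 3 ((suc y₁ * suc y₂) * suc n) refl refl)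
    (+*+ _ 1 (trans (cong₂ ℤ._+_ (+*+ _ (suc n) (↥-+ x₁ y₁ x₂ y₂) refl) (+*+ 1 (suc y₁ * suc y₂) refl refl))
                    (sym (ℤP.pos-+ ((x₁ * suc y₂ + x₂ * suc y₁) * suc n) (1 * (suc y₁ * suc y₂))))) refl)
    (subst₂ _≤_ (lhs (suc y₁ * suc y₂) (suc n)) (rhs (x₁ * suc y₂ + x₂ * suc y₁) (suc y₁ * suc y₂) (suc n)) le)
  where
  open +-*-Solver
  lhs : ∀ B N → N * (3 * B) ≡ 3 * (B * N)
  lhs = solve 2 (λ B N → N :* (con 3 :* B) := con 3 :* (B :* N)) refl
  rhs : ∀ A B N → N * A + B ≡ (A * N + 1 * B) * 1
  rhs = solve 3 (λ A B N → N :* A :+ B := (A :* N :+ con 1 :* B) :* con 1) refl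

value≤3+⇒lamApprox≤ : ∀ y k n → Value≤3+ n (rightWindow y k) (leftWindow y k) →
  lamApprox y k ℚ.≤ three ℚ.+ 1/[1+ n ]
value≤3+⇒lamApprox≤ y k n le = subst (ℚ._≤ three ℚ.+ 1/[1+ n ]) (sym (lamApprox≡windowValue y k))
  (go (num R) (den R) (den L) (num L) (num-pos R) (num-pos R′) (num-pos L′) (num-pos L) le)
  where
  R = rightWindow y k
  L = leftWindow y k
  R′ = applyUpTo (λ j → y (+ suc j)) k
  L′ = applyUpTo (λ j → y -[1+ suc j ]) k
  go : ∀ x₁ y₁ x₂ y₂ → 1 ≤ x₁ → 1 ≤ y₁ → 1 ≤ x₂ → 1 ≤ y₂ →
       suc n * (x₁ * y₂ + x₂ * y₁) ≤ suc n * (3 * (y₁ * y₂)) + y₁ * y₂ →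
       mkℚᵘ (+ suc (pred x₁)) (pred y₁) ℚ.+ mkℚᵘ (+ suc (pred x₂)) (pred y₂) ℚ.≤ three ℚ.+ 1/[1+ n ]
  go (suc x₁) (suc y₁) (suc x₂) (suc y₂) _ _ _ _ = sum≤3+ (suc x₁) y₁ (suc x₂) y₂ n

value≥3-⇒lamApprox≥ : ∀ y k n → Value≥3- n (rightWindow y k) (leftWindow y k) →
  three ℚ.≤ lamApprox y k ℚ.+ 1/[1+ n ]
value≥3-⇒lamApprox≥ y k n le = subst (λ z → three ℚ.≤ z ℚ.+ 1/[1+ n ]) (sym (lamApprox≡windowValue y k))
  (go (num R) (den R) (den L) (num L) (num-pos R) (num-pos R′) (num-pos L′) (num-pos L) le)
  where
  R = rightWindow y k
  L = leftWindow y k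
  R′ = applyUpTo (λ j → y (+ suc j)) k
  L′ = applyUpTo (λ j → y -[1+ suc j ]) k
  go : ∀ x₁ y₁ x₂ y₂ → 1 ≤ x₁ → 1 ≤ y₁ → 1 ≤ x₂ → 1 ≤ y₂ →
       suc n * (3 * (y₁ * y₂)) ≤ suc n * (x₁ * y₂ + x₂ * y₁) + y₁ * y₂ →
       three ℚ.≤ (mkℚᵘ (+ suc (pred x₁)) (pred y₁) ℚ.+ mkℚᵘ (+ suc (pred x₂)) (pred y₂)) ℚ.+ 1/[1+ n ]
  go (suc x₁) (suc y₁) (suc x₂) (suc y₂) _ _ _ _ = 3≤sum+ (suc x₁) y₁ (suc x₂) y₂ n

archimedean : ∀ ε → 0ℚᵘ ℚ.< ε → ∃ λ N → 1/[1+ N ] ℚ.≤ ε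
archimedean (mkℚᵘ (+ suc m) d) _ =
  d , ≤-by-cross (1 * suc d) (suc m * suc d) (+*+ 1 (suc d) refl refl) (+*+ (suc m) (suc d) refl refl)
        (*-monoˡ-≤ (suc d) (s≤s (z≤n {m})))
archimedean (mkℚᵘ (+ zero) d) ε>0 with ℚP.>0⇒↥>0 ε>0
... | ℤ.+<+ ()
archimedean (mkℚᵘ -[1+ m ] d) ε>0 with ℚP.>0⇒↥>0 ε>0
... | ()

Word : Set
Word = List AB

-- Lexicographic order with b < a, in which a word and its extensions are comparable both ways.
data _≤lex_ : Word → Word → Set where
  []≤lex : ∀ {t} → [] ≤lex t
  ≤lex[] : ∀ {s} → s ≤lex []
  b<a    : ∀ {s t} → (b ∷ s) ≤lex (a ∷ t)
  ∷≤lex  : ∀ {x s t} → s ≤lex t → (x ∷ s) ≤lex (x ∷ t)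

≤lex-prefixˡ : ∀ {s s′ t} → (s ++ s′) ≤lex t → s ≤lex t
≤lex-prefixˡ {[]}    _           = []≤lex
≤lex-prefixˡ {_ ∷ _} ≤lex[]      = ≤lex[]
≤lex-prefixˡ {b ∷ _} b<a         = b<a
≤lex-prefixˡ {_ ∷ _} (∷≤lex s≤t) = ∷≤lex (≤lex-prefixˡ s≤t)

≤lex-prefixʳ : ∀ {s t t′} → s ≤lex (t ++ t′) → s ≤lex t
≤lex-prefixʳ {t = []}    _           = ≤lex[]
≤lex-prefixʳ {t = _ ∷ _} []≤lex      = []≤lex
≤lex-prefixʳ {t = a ∷ _} b<a         = b<a
≤lex-prefixʳ {t = _ ∷ _} (∷≤lex s≤t) = ∷≤lex (≤lex-prefixʳ s≤t)

WellFlanked : Word → Set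
WellFlanked w = (∀ u v → w ≡ u ++ a ∷ b ∷ v → reverse u ≤lex v)
              × (∀ u v → w ≡ u ++ b ∷ a ∷ v → v ≤lex reverse u)

++-∷≢[] : ∀ (u : Word) {x v} → ¬ (u ++ x ∷ v ≡ [])
++-∷≢[] []      ()
++-∷≢[] (_ ∷ _) ()

reverse-factor : ∀ (w u : Word) x y v → reverse w ≡ u ++ x ∷ y ∷ v → w ≡ reverse v ++ y ∷ x ∷ reverse u
reverse-factor w u x y v e = begin
  w                                        ≡⟨ sym (reverse-involutive w) ⟩
  reverse (reverse w)                      ≡⟨ cong reverse e ⟩
  reverse (u ++ (x ∷ y ∷ []) ++ v)         ≡⟨ reverse-++ u ((x ∷ y ∷ []) ++ v) ⟩
  reverse ((x ∷ y ∷ []) ++ v) ++ reverse u ≡⟨ cong (_++ reverse u) (reverse-++ (x ∷ y ∷ []) v) ⟩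
  (reverse v ++ y ∷ x ∷ []) ++ reverse u   ≡⟨ ++-assoc (reverse v) (y ∷ x ∷ []) (reverse u) ⟩
  reverse v ++ y ∷ x ∷ reverse u           ∎
  where open ≡-Reasoning

wellFlanked-reverse : ∀ w → WellFlanked w → WellFlanked (reverse w)
wellFlanked-reverse w (flank-ab , flank-ba) =
    (λ u v e → subst (reverse u ≤lex_) (reverse-involutive v)
                 (flank-ba (reverse v) (reverse u) (reverse-factor w u a b v e)))
  , (λ u v e → subst (_≤lex reverse u) (reverse-involutive v)
                 (flank-ab (reverse v) (reverse u) (reverse-factor w u b a v e)))

swapAB : AB → AB
swapAB a = b
swapAB b = a

mirror : Word → Word
mirror w = map swapAB (reverse w)

map-swapAB-involutive : ∀ w → map swapAB (map swapAB w) ≡ w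
map-swapAB-involutive []      = refl
map-swapAB-involutive (a ∷ w) = cong (a ∷_) (map-swapAB-involutive w)
map-swapAB-involutive (b ∷ w) = cong (b ∷_) (map-swapAB-involutive w)

reverse-mirror : ∀ w → reverse (mirror w) ≡ map swapAB w
reverse-mirror w = trans (sym (reverse-map swapAB (reverse w))) (cong (map swapAB) (reverse-involutive w))

mirror-involutive : ∀ w → mirror (mirror w) ≡ w
mirror-involutive w = trans (cong (map swapAB) (reverse-mirror w)) (map-swapAB-involutive w)

mirror-++ : ∀ u v → mirror (u ++ v) ≡ mirror v ++ mirror u
mirror-++ u v = trans (cong (map swapAB) (reverse-++ u v)) (map-++ swapAB (reverse v) (reverse u))

mirror-factor : ∀ (w u : Word) x y v → mirror w ≡ u ++ x ∷ y ∷ v → w ≡ mirror v ++ swapAB y ∷ swapAB x ∷ mirror u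
mirror-factor w u x y v e = begin
  w                                         ≡⟨ sym (mirror-involutive w) ⟩
  mirror (mirror w)                         ≡⟨ cong mirror e ⟩
  mirror (u ++ (x ∷ y ∷ []) ++ v)           ≡⟨ mirror-++ u ((x ∷ y ∷ []) ++ v) ⟩
  mirror ((x ∷ y ∷ []) ++ v) ++ mirror u    ≡⟨ cong (_++ mirror u) (mirror-++ (x ∷ y ∷ []) v) ⟩
  (mirror v ++ swapAB y ∷ swapAB x ∷ []) ++ mirror u
                                            ≡⟨ ++-assoc (mirror v) (swapAB y ∷ swapAB x ∷ []) (mirror u) ⟩
  mirror v ++ swapAB y ∷ swapAB x ∷ mirror u ∎
  where open ≡-Reasoning

≤lex-swapAB : ∀ {s t} → s ≤lex t → map swapAB t ≤lex map swapAB s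
≤lex-swapAB []≤lex      = ≤lex[]
≤lex-swapAB ≤lex[]      = []≤lex
≤lex-swapAB b<a         = b<a
≤lex-swapAB (∷≤lex s≤t) = ∷≤lex (≤lex-swapAB s≤t)

≤lex-unswap : ∀ {s t} → map swapAB s ≤lex map swapAB t → t ≤lex s
≤lex-unswap {s} {t} le = subst₂ _≤lex_ (map-swapAB-involutive t) (map-swapAB-involutive s) (≤lex-swapAB le)

wellFlanked-mirror : ∀ w → WellFlanked w → WellFlanked (mirror w)
wellFlanked-mirror w (flank-ab , flank-ba) =
    (λ u v e → ≤lex-unswap (subst (_≤lex mirror u) (reverse-mirror v)
                               (flank-ab (mirror v) (mirror u) (mirror-factor w u a b v e))))
  , (λ u v e → ≤lex-unswap (subst (mirror u ≤lex_) (reverse-mirror v)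
                               (flank-ba (mirror v) (mirror u) (mirror-factor w u b a v e))))

-- Ū and V̄ act on (αₙ , βₙ) through φU and φV (pairs≡φ* below); φU′ is a conjugate of φU.
φU : Word → Word
φU []      = []
φU (a ∷ w) = a ∷ b ∷ φU w
φU (b ∷ w) = b ∷ φU w

φU′ : Word → Word
φU′ []      = []
φU′ (a ∷ w) = b ∷ a ∷ φU′ w
φU′ (b ∷ w) = b ∷ φU′ w

φV : Word → Word
φV []      = []
φV (a ∷ w) = a ∷ φV w
φV (b ∷ w) = a ∷ b ∷ φV w

φU-++ : ∀ u v → φU (u ++ v) ≡ φU u ++ φU v
φU-++ []      v = refl
φU-++ (a ∷ u) v = cong (λ z → a ∷ b ∷ z) (φU-++ u v)
φU-++ (b ∷ u) v = cong (b ∷_) (φU-++ u v)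

φU′-++ : ∀ u v → φU′ (u ++ v) ≡ φU′ u ++ φU′ v
φU′-++ []      v = refl
φU′-++ (a ∷ u) v = cong (λ z → b ∷ a ∷ z) (φU′-++ u v)
φU′-++ (b ∷ u) v = cong (b ∷_) (φU′-++ u v)

φV-++ : ∀ u v → φV (u ++ v) ≡ φV u ++ φV v
φV-++ []      v = refl
φV-++ (a ∷ u) v = cong (a ∷_) (φV-++ u v)
φV-++ (b ∷ u) v = cong (λ z → a ∷ b ∷ z) (φV-++ u v)

reverse-φU : ∀ w → reverse (φU w) ≡ φU′ (reverse w)
reverse-φU []      = refl
reverse-φU (x ∷ w) = begin
  reverse (φU ([ x ] ++ w))          ≡⟨ cong reverse (φU-++ [ x ] w) ⟩
  reverse (φU [ x ] ++ φU w)         ≡⟨ reverse-++ (φU [ x ]) (φU w) ⟩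
  reverse (φU w) ++ reverse (φU [ x ]) ≡⟨ cong₂ _++_ (reverse-φU w) (single x) ⟩
  φU′ (reverse w) ++ φU′ [ x ]       ≡⟨ sym (φU′-++ (reverse w) [ x ]) ⟩
  φU′ (reverse w ++ [ x ])           ≡⟨ cong φU′ (sym (unfold-reverse x w)) ⟩
  φU′ (reverse (x ∷ w))              ∎
  where
  open ≡-Reasoning
  single : ∀ x → reverse (φU [ x ]) ≡ φU′ [ x ]
  single a = refl
  single b = refl

φU′-∷ʳ-b : ∀ s → φU′ s ++ [ b ] ≡ b ∷ φU s
φU′-∷ʳ-b []      = refl
φU′-∷ʳ-b (a ∷ s) = cong (λ z → b ∷ a ∷ z) (φU′-∷ʳ-b s)
φU′-∷ʳ-b (b ∷ s) = cong (b ∷_) (φU′-∷ʳ-b s)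

φV≡mirror∘φU∘mirror : ∀ w → φV w ≡ mirror (φU (mirror w))
φV≡mirror∘φU∘mirror []      = refl
φV≡mirror∘φU∘mirror (x ∷ w) = begin
  φV ([ x ] ++ w)                                   ≡⟨ φV-++ [ x ] w ⟩
  φV [ x ] ++ φV w                                  ≡⟨ cong₂ _++_ (single x) (φV≡mirror∘φU∘mirror w) ⟩
  mirror (φU (mirror [ x ])) ++ mirror (φU (mirror w)) ≡⟨ sym (mirror-++ (φU (mirror w)) (φU (mirror [ x ]))) ⟩
  mirror (φU (mirror w) ++ φU (mirror [ x ]))       ≡⟨ cong mirror (sym (φU-++ (mirror w) (mirror [ x ]))) ⟩
  mirror (φU (mirror w ++ mirror [ x ]))            ≡⟨ cong (λ z → mirror (φU z)) (sym (mirror-++ [ x ] w)) ⟩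
  mirror (φU (mirror (x ∷ w)))                      ∎
  where
  open ≡-Reasoning
  single : ∀ x → φV [ x ] ≡ mirror (φU (mirror [ x ]))
  single a = refl
  single b = refl

φU-mono : ∀ {s t} → s ≤lex t → φU s ≤lex φU t
φU-mono []≤lex          = []≤lex
φU-mono ≤lex[]          = ≤lex[]
φU-mono b<a             = b<a
φU-mono (∷≤lex {a} s≤t) = ∷≤lex (∷≤lex (φU-mono s≤t))
φU-mono (∷≤lex {b} s≤t) = ∷≤lex (φU-mono s≤t)

φU′≤lex-b∷φU : ∀ {s t} → s ≤lex t → φU′ s ≤lex (b ∷ φU t)
φU′≤lex-b∷φU {s} s≤t = ≤lex-prefixˡ (subst (_≤lex _) (sym (φU′-∷ʳ-b s)) (∷≤lex (φU-mono s≤t)))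

b∷φU≤lex-φU′ : ∀ {s t} → t ≤lex s → (b ∷ φU t) ≤lex φU′ s
b∷φU≤lex-φU′ {s} t≤s = ≤lex-prefixʳ (subst (_ ≤lex_) (sym (φU′-∷ʳ-b s)) (∷≤lex (φU-mono t≤s)))

φU′≤lex-φU-a∷ : ∀ s t → φU′ s ≤lex φU (a ∷ t)
φU′≤lex-φU-a∷ []      t = []≤lex
φU′≤lex-φU-a∷ (a ∷ s) t = b<a
φU′≤lex-φU-a∷ (b ∷ s) t = b<a

φU-split-a : ∀ w u r → φU w ≡ u ++ a ∷ r →
  ∃ λ w₁ → ∃ λ w₂ → (w ≡ w₁ ++ a ∷ w₂) × (u ≡ φU w₁) × (r ≡ b ∷ φU w₂)
φU-split-a (a ∷ w) []          r refl = [] , w , refl , refl , refl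
φU-split-a (a ∷ w) (_ ∷ _ ∷ u) r e with ∷-injective e
... | refl , e′ with ∷-injective e′
... | refl , e″ with φU-split-a w u r e″
... | w₁ , w₂ , refl , refl , refl = a ∷ w₁ , w₂ , refl , refl , refl
φU-split-a (b ∷ w) (_ ∷ u)     r e with ∷-injective e
... | refl , e′ with φU-split-a w u r e′
... | w₁ , w₂ , refl , refl , refl = b ∷ w₁ , w₂ , refl , refl , refl
φU-split-a []      []          r ()
φU-split-a []      (_ ∷ _)     r ()
φU-split-a (b ∷ w) []          r ()
φU-split-a (a ∷ w) (_ ∷ [])    r ()

φU-split-ba : ∀ w u v → φU w ≡ u ++ b ∷ a ∷ v →
    (∃ λ w₁ → ∃ λ w₂ → (w ≡ w₁ ++ b ∷ a ∷ w₂) × (u ≡ φU w₁) × (v ≡ b ∷ φU w₂))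
  ⊎ (∃ λ w₁ → ∃ λ w₂ → (w ≡ w₁ ++ a ∷ a ∷ w₂) × (u ≡ φU w₁ ++ [ a ]) × (v ≡ b ∷ φU w₂))
φU-split-ba w u v e with φU-split-a w (u ++ [ b ]) v (trans e (sym (++-assoc u [ b ] (a ∷ v))))
... | w₁ , w₂ , refl , eu , refl with initLast w₁
... | [] = ⊥-elim (++-∷≢[] u eu)
... | w₁′ ∷ʳ′ a = inj₂ (w₁′ , w₂ , ++-assoc w₁′ [ a ] (a ∷ w₂) ,
        ∷ʳ-injectiveˡ u (φU w₁′ ++ [ a ]) (trans eu (trans (φU-++ w₁′ [ a ]) (sym (++-assoc (φU w₁′) [ a ] [ b ])))) ,
        refl)
... | w₁′ ∷ʳ′ b = inj₁ (w₁′ , w₂ , ++-assoc w₁′ [ b ] (a ∷ w₂) ,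
        ∷ʳ-injectiveˡ u (φU w₁′) (trans eu (φU-++ w₁′ [ b ])) , refl)

wellFlanked-φU : ∀ w → WellFlanked w → WellFlanked (φU w)
wellFlanked-φU w (flank-ab , flank-ba) = flank-ab′ , flank-ba′
  where
  flank-ab′ : ∀ u v → φU w ≡ u ++ a ∷ b ∷ v → reverse u ≤lex v
  flank-ab′ u v e with φU-split-a w u (b ∷ v) e
  ... | w₁ , w₂ , ew , refl , ev rewrite reverse-φU w₁ | ∷-injectiveʳ ev = after-a w₂ ew
    where
    after-a : ∀ w₂ → w ≡ w₁ ++ a ∷ w₂ → φU′ (reverse w₁) ≤lex φU w₂
    after-a []       _  = ≤lex[]
    after-a (a ∷ w₂) _  = φU′≤lex-φU-a∷ (reverse w₁) w₂
    after-a (b ∷ w₂) ew = φU′≤lex-b∷φU (flank-ab w₁ w₂ ew)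
  flank-ba′ : ∀ u v → φU w ≡ u ++ b ∷ a ∷ v → v ≤lex reverse u
  flank-ba′ u v e with φU-split-ba w u v e
  ... | inj₁ (w₁ , w₂ , ew , refl , refl) rewrite reverse-φU w₁ = b∷φU≤lex-φU′ (flank-ba w₁ w₂ ew)
  ... | inj₂ (w₁ , w₂ , ew , refl , refl) rewrite reverse-++ (φU w₁) [ a ] = b<a

-- V̄ is Ū conjugated by the mirror map.
wellFlanked-φV : ∀ w → WellFlanked w → WellFlanked (φV w)
wellFlanked-φV w flanked = subst WellFlanked (sym (φV≡mirror∘φU∘mirror w))
  (wellFlanked-mirror _ (wellFlanked-φU _ (wellFlanked-mirror w flanked)))

φ : Move → Word → Word
φ U = φU
φ V = φV

φ-++ : ∀ m u v → φ m (u ++ v) ≡ φ m u ++ φ m v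
φ-++ U = φU-++
φ-++ V = φV-++

wellFlanked-φ : ∀ m w → WellFlanked w → WellFlanked (φ m w)
wellFlanked-φ U = wellFlanked-φU
wellFlanked-φ V = wellFlanked-φV

φ* : (ℕ → Move) → ℕ → Word → Word
φ* R zero    w = w
φ* R (suc n) w = φ* R n (φ (R n) w)

φ*-++ : ∀ R n u v → φ* R n (u ++ v) ≡ φ* R n u ++ φ* R n v
φ*-++ R zero    u v = refl
φ*-++ R (suc n) u v = trans (cong (φ* R n) (φ-++ (R n) u v)) (φ*-++ R n (φ (R n) u) (φ (R n) v))

wellFlanked-φ* : ∀ R n w → WellFlanked w → WellFlanked (φ* R n w)
wellFlanked-φ* R zero    w flanked = flanked
wellFlanked-φ* R (suc n) w flanked = wellFlanked-φ* R n (φ (R n) w) (wellFlanked-φ (R n) w flanked)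

α β : (ℕ → Move) → ℕ → Word
α R n = proj₁ (pairs R n)
β R n = proj₂ (pairs R n)

pairs≡φ* : ∀ R n → pairs R n ≡ (φ* R n [ a ] , φ* R n [ b ])
pairs≡φ* R zero = refl
pairs≡φ* R (suc n) rewrite pairs≡φ* R n with R n
... | U = cong (_, φ* R n [ b ]) (sym (φ*-++ R n [ a ] [ b ]))
... | V = cong (φ* R n [ a ] ,_) (sym (φ*-++ R n [ a ] [ b ]))

wellFlanked-ba : WellFlanked (b ∷ a ∷ [])
wellFlanked-ba = flank-ab , flank-ba
  where
  flank-ab : ∀ u v → b ∷ a ∷ [] ≡ u ++ a ∷ b ∷ v → reverse u ≤lex v
  flank-ab (_ ∷ _ ∷ []) v ()
  flank-ab (_ ∷ _ ∷ _ ∷ _) v ()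
  flank-ba : ∀ u v → b ∷ a ∷ [] ≡ u ++ b ∷ a ∷ v → v ≤lex reverse u
  flank-ba [] [] refl = []≤lex
  flank-ba (_ ∷ _ ∷ []) v ()
  flank-ba (_ ∷ _ ∷ _ ∷ _) v ()

wellFlanked-βα : ∀ R n → WellFlanked (β R n ++ α R n)
wellFlanked-βα R n rewrite pairs≡φ* R n =
  subst WellFlanked (φ*-++ R n [ b ] [ a ]) (wellFlanked-φ* R n (b ∷ a ∷ []) wellFlanked-ba)

induction-from : ∀ {P : ℕ → Set} m₀ → P m₀ → (∀ m → m₀ ≤ m → P m → P (suc m)) → ∀ {m} → m₀ ≤ m → P m
induction-from {P} m₀ base step m₀≤m with m≤n⇒∃[o]m+o≡n m₀≤m
... | d , refl = go d
  where
  go : ∀ d → P (m₀ + d)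
  go zero    = subst P (sym (+-identityʳ m₀)) base
  go (suc d) = subst P (sym (+-suc m₀ d)) (step (m₀ + d) (m≤m+n m₀ d) (go d))

module _ {A : Set} where

  Growing : (ℕ → List A) → Set
  Growing s = ∀ i → ∃ λ Z → s (suc i) ≡ s i ++ Z

  Unbounded : (ℕ → List A) → Set
  Unbounded s = ∀ L → ∃ λ i → L ≤ length (s i)

  growing-≤ : ∀ {s} → Growing s → ∀ {i j} → i ≤ j → ∃ λ Z → s j ≡ s i ++ Z
  growing-≤ {s} grow {i} = induction-from i ([] , sym (++-identityʳ (s i))) step
    where
    step : ∀ j → i ≤ j → (∃ λ Z → s j ≡ s i ++ Z) → ∃ λ Z → s (suc j) ≡ s i ++ Z
    step j _ (Z , e) with grow j
    ... | Z′ , e′ = Z ++ Z′ , trans e′ (trans (cong (_++ Z′) e) (++-assoc (s i) Z Z′))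

  length-++ˡ : ∀ {x Z : List A} y → x ≡ y ++ Z → length y ≤ length x
  length-++ˡ {Z = Z} y refl = subst (length y ≤_) (sym (length-++ y)) (m≤m+n (length y) (length Z))

  length-++ʳ : ∀ {x Z : List A} y → x ≡ Z ++ y → length y ≤ length x
  length-++ʳ {Z = Z} y refl = subst (length y ≤_) (sym (length-++ Z)) (m≤n+m (length y) (length Z))

  length-growing : ∀ {s} → Growing s → ∀ {i j} → i ≤ j → length (s i) ≤ length (s j)
  length-growing {s} grow {i} i≤j = length-++ˡ (s i) (proj₂ (growing-≤ grow i≤j))

α-growing : ∀ R → Growing (α R)
α-growing R i with R i
... | U = β R i , refl
... | V = [] , sym (++-identityʳ (α R i))

reverse-β-growing : ∀ R → Growing (λ i → reverse (β R i))
reverse-β-growing R i with R i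
... | U = [] , sym (++-identityʳ _)
... | V = reverse (α R i) , reverse-++ (α R i) (β R i)

α-prefix : ∀ R {n m} → n ≤ m → ∃ λ Z → α R m ≡ α R n ++ Z
α-prefix R = growing-≤ (α-growing R)

β-suffix : ∀ R {n m} → n ≤ m → ∃ λ Z → β R m ≡ Z ++ β R n
β-suffix R {n} {m} n≤m with growing-≤ (reverse-β-growing R) n≤m
... | Z , e = reverse Z , (begin
  β R m                                ≡⟨ sym (reverse-involutive (β R m)) ⟩
  reverse (reverse (β R m))            ≡⟨ cong reverse e ⟩
  reverse (reverse (β R n) ++ Z)       ≡⟨ reverse-++ (reverse (β R n)) Z ⟩
  reverse Z ++ reverse (reverse (β R n)) ≡⟨ cong (reverse Z ++_) (reverse-involutive (β R n)) ⟩
  reverse Z ++ β R n                   ∎)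
  where open ≡-Reasoning

1≤length-α : ∀ R n → 1 ≤ length (α R n)
1≤length-α R n = length-growing (α-growing R) {0} {n} z≤n

1≤length-β : ∀ R n → 1 ≤ length (β R n)
1≤length-β R n = subst (1 ≤_) (length-reverse (β R n)) (length-growing (reverse-β-growing R) {0} {n} z≤n)

α-unbounded : ∀ R → InfinitelyOften R U → Unbounded (α R)
α-unbounded R oftenU zero = 0 , z≤n
α-unbounded R oftenU (suc L) with α-unbounded R oftenU L
... | n , L≤ with oftenU n
... | j , n≤j , Rj≡U = suc j , ≤-trans (s≤s (≤-trans L≤ (length-growing (α-growing R) n≤j))) (grows Rj≡U)
  where
  grows : R j ≡ U → suc (length (α R j)) ≤ length (α R (suc j))
  grows e rewrite e | length-++ (α R j) {β R j} =
    subst (_≤ length (α R j) + length (β R j)) (+-comm (length (α R j)) 1) (+-monoʳ-≤ (length (α R j)) (1≤length-β R j))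

β-unbounded : ∀ R → InfinitelyOften R V → Unbounded (β R)
β-unbounded R oftenV zero = 0 , z≤n
β-unbounded R oftenV (suc L) with β-unbounded R oftenV L
... | n , L≤ with oftenV n
... | j , n≤j , Rj≡V = suc j , ≤-trans (s≤s (≤-trans L≤ (length-++ʳ (β R n) (proj₂ (β-suffix R n≤j))))) (grows Rj≡V)
  where
  grows : R j ≡ V → suc (length (β R j)) ≤ length (β R (suc j))
  grows e rewrite e | length-++ (α R j) {β R j} = +-monoˡ-≤ (length (β R j)) (1≤length-α R j)

eventually-long : ∀ R → InfinitelyOften R U → InfinitelyOften R V → ∀ L →
  ∃ λ n → ∀ m → n ≤ m → (L ≤ length (α R m)) × (L ≤ length (β R m))
eventually-long R oftenU oftenV L with α-unbounded R oftenU L | β-unbounded R oftenV L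
... | n₁ , L≤α | n₂ , L≤β = n₁ + n₂ , λ m n≤m →
    ≤-trans L≤α (length-growing (α-growing R) (≤-trans (m≤m+n n₁ n₂) n≤m))
  , ≤-trans L≤β (length-++ʳ (β R n₂) (proj₂ (β-suffix R (≤-trans (m≤n+m n₂ n₁) n≤m))))

Palindrome : Word → Set
Palindrome w = reverse w ≡ w

palindrome-wrap : ∀ x w → Palindrome w → Palindrome (x ∷ w ++ [ x ])
palindrome-wrap x w pal = begin
  reverse (x ∷ w ++ [ x ])   ≡⟨ reverse-++ (x ∷ w) [ x ] ⟩
  x ∷ reverse (x ∷ w)        ≡⟨ cong (x ∷_) (unfold-reverse x w) ⟩
  x ∷ (reverse w ++ [ x ])   ≡⟨ cong (λ z → x ∷ (z ++ [ x ])) pal ⟩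
  x ∷ w ++ [ x ]             ∎
  where open ≡-Reasoning

palindrome-sandwich : ∀ X Y → Palindrome X → Palindrome Y → Palindrome (X ++ Y ++ X)
palindrome-sandwich X Y palX palY = begin
  reverse (X ++ Y ++ X)                 ≡⟨ reverse-++ X (Y ++ X) ⟩
  reverse (Y ++ X) ++ reverse X         ≡⟨ cong (_++ reverse X) (reverse-++ Y X) ⟩
  (reverse X ++ reverse Y) ++ reverse X ≡⟨ cong₂ (λ u v → (u ++ v) ++ u) palX palY ⟩
  (X ++ Y) ++ X                         ≡⟨ ++-assoc X Y X ⟩
  X ++ Y ++ X                           ∎
  where open ≡-Reasoning

palindrome-≡ : ∀ {x y} → x ≡ y → Palindrome y → Palindrome x
palindrome-≡ refl pal = pal

PalindromeB : Word → Set
PalindromeB A = (A ≡ []) ⊎ (∃ λ P → (A ≡ P ++ [ b ]) × Palindrome P)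

APalindrome : Word → Set
APalindrome B = (B ≡ []) ⊎ (∃ λ Q → (B ≡ a ∷ Q) × Palindrome Q)

-- αₙ = a A and βₙ = B b with Central A B: the Christoffel words with their central palindromes.
Central : Word → Word → Set
Central A B = Palindrome (A ++ B) × PalindromeB A × APalindrome B

palindrome-swap : ∀ P Q → Palindrome P → Palindrome Q → Palindrome ((P ++ [ b ]) ++ a ∷ Q) →
  (P ++ [ b ]) ++ a ∷ Q ≡ Q ++ a ∷ b ∷ P
palindrome-swap P Q palP palQ pal = begin
  (P ++ [ b ]) ++ a ∷ Q                     ≡⟨ sym pal ⟩
  reverse ((P ++ [ b ]) ++ a ∷ Q)           ≡⟨ reverse-++ (P ++ [ b ]) (a ∷ Q) ⟩
  reverse (a ∷ Q) ++ reverse (P ++ [ b ])   ≡⟨ cong₂ _++_ (unfold-reverse a Q) (reverse-++ P [ b ]) ⟩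
  (reverse Q ++ [ a ]) ++ b ∷ reverse P     ≡⟨ cong₂ (λ u v → (u ++ [ a ]) ++ b ∷ v) palQ palP ⟩
  (Q ++ [ a ]) ++ b ∷ P                     ≡⟨ ++-assoc Q [ a ] (b ∷ P) ⟩
  Q ++ a ∷ b ∷ P                            ∎
  where open ≡-Reasoning

palindrome-U : ∀ A B → Palindrome (A ++ B) → PalindromeB A → APalindrome B → Palindrome (((A ++ B) ++ [ b ]) ++ B)
palindrome-U .[] B pal (inj₁ refl) _ = palindrome-≡ (++-assoc B [ b ] B) (palindrome-sandwich B [ b ] pal refl)
palindrome-U .(P ++ [ b ]) .[] pal (inj₂ (P , refl , palP)) (inj₁ refl) =
  palindrome-≡ (trans (cong (λ z → (z ++ [ b ]) ++ []) (++-identityʳ (P ++ [ b ])))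
                      (trans (++-identityʳ _) (cong (_++ [ b ]) Pb≡bP)))
               (palindrome-wrap b P palP)
  where
  open ≡-Reasoning
  Pb≡bP : P ++ [ b ] ≡ b ∷ P
  Pb≡bP = begin
    P ++ [ b ]            ≡⟨ sym (palindrome-≡ (sym (++-identityʳ (P ++ [ b ]))) pal) ⟩
    reverse (P ++ [ b ])  ≡⟨ reverse-++ P [ b ] ⟩
    b ∷ reverse P         ≡⟨ cong (b ∷_) palP ⟩
    b ∷ P                 ∎
palindrome-U .(P ++ [ b ]) .(a ∷ Q) pal (inj₂ (P , refl , palP)) (inj₂ (Q , refl , palQ)) =
  palindrome-≡ rearrange (palindrome-sandwich Q (a ∷ (b ∷ P ++ [ b ]) ++ [ a ]) palQ
                            (palindrome-wrap a _ (palindrome-wrap b P palP)))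
  where
  open ≡-Reasoning
  rearrange : (((P ++ [ b ]) ++ a ∷ Q) ++ [ b ]) ++ a ∷ Q ≡ Q ++ (a ∷ (b ∷ P ++ [ b ]) ++ [ a ]) ++ Q
  rearrange = begin
    (((P ++ [ b ]) ++ a ∷ Q) ++ [ b ]) ++ a ∷ Q ≡⟨ cong (λ z → (z ++ [ b ]) ++ a ∷ Q) (palindrome-swap P Q palP palQ pal) ⟩
    ((Q ++ a ∷ b ∷ P) ++ [ b ]) ++ a ∷ Q        ≡⟨ ++-assoc (Q ++ a ∷ b ∷ P) [ b ] (a ∷ Q) ⟩
    (Q ++ a ∷ b ∷ P) ++ b ∷ a ∷ Q               ≡⟨ ++-assoc Q (a ∷ b ∷ P) (b ∷ a ∷ Q) ⟩
    Q ++ a ∷ b ∷ (P ++ b ∷ a ∷ Q)               ≡⟨ cong (λ z → Q ++ a ∷ b ∷ z) (sym (++-assoc P [ b ] (a ∷ Q))) ⟩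
    Q ++ a ∷ b ∷ ((P ++ [ b ]) ++ a ∷ Q)        ≡⟨ cong (λ z → Q ++ a ∷ b ∷ z) (sym (++-assoc (P ++ [ b ]) [ a ] Q)) ⟩
    Q ++ (a ∷ (b ∷ P ++ [ b ]) ++ [ a ]) ++ Q   ∎

palindrome-V : ∀ A B → Palindrome (A ++ B) → PalindromeB A → APalindrome B → Palindrome (A ++ a ∷ (A ++ B))
palindrome-V .[] .[] pal (inj₁ refl) (inj₁ refl) = refl
palindrome-V .[] .(a ∷ Q) pal (inj₁ refl) (inj₂ (Q , refl , palQ)) =
  palindrome-≡ (cong (a ∷_) (sym Qa≡aQ)) (palindrome-wrap a Q palQ)
  where
  Qa≡aQ : Q ++ [ a ] ≡ a ∷ Q
  Qa≡aQ = trans (cong (_++ [ a ]) (sym palQ)) (trans (sym (unfold-reverse a Q)) pal)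
palindrome-V .(P ++ [ b ]) .[] pal (inj₂ (P , refl , palP)) (inj₁ refl) =
  palindrome-≡ (cong (λ z → (P ++ [ b ]) ++ a ∷ z) (++-identityʳ (P ++ [ b ])))
               (palindrome-sandwich (P ++ [ b ]) [ a ] (palindrome-≡ (sym (++-identityʳ (P ++ [ b ]))) pal) refl)
palindrome-V .(P ++ [ b ]) .(a ∷ Q) pal (inj₂ (P , refl , palP)) (inj₂ (Q , refl , palQ)) =
  palindrome-≡ rearrange (palindrome-sandwich P (b ∷ (a ∷ Q ++ [ a ]) ++ [ b ]) palP
                            (palindrome-wrap b _ (palindrome-wrap a Q palQ)))
  where
  open ≡-Reasoning
  rearrange : (P ++ [ b ]) ++ a ∷ ((P ++ [ b ]) ++ a ∷ Q) ≡ P ++ (b ∷ (a ∷ Q ++ [ a ]) ++ [ b ]) ++ P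
  rearrange = begin
    (P ++ [ b ]) ++ a ∷ ((P ++ [ b ]) ++ a ∷ Q) ≡⟨ cong (λ z → (P ++ [ b ]) ++ a ∷ z) (palindrome-swap P Q palP palQ pal) ⟩
    (P ++ [ b ]) ++ a ∷ (Q ++ a ∷ b ∷ P)        ≡⟨ ++-assoc P [ b ] _ ⟩
    P ++ b ∷ a ∷ (Q ++ a ∷ b ∷ P)               ≡⟨ cong (λ z → P ++ b ∷ a ∷ z) (sym (++-assoc Q [ a ] (b ∷ P))) ⟩
    P ++ b ∷ a ∷ ((Q ++ [ a ]) ++ b ∷ P)        ≡⟨ cong (λ z → P ++ b ∷ z) (sym (++-assoc (a ∷ Q ++ [ a ]) [ b ] P)) ⟩
    P ++ (b ∷ (a ∷ Q ++ [ a ]) ++ [ b ]) ++ P   ∎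

central-U : ∀ A B → Central A B → Central ((A ++ B) ++ [ b ]) B
central-U A B (pal , palA , palB) = palindrome-U A B pal palA palB , inj₂ (A ++ B , refl , pal) , palB

central-V : ∀ A B → Central A B → Central A (a ∷ (A ++ B))
central-V A B (pal , palA , palB) = palindrome-V A B pal palA palB , palA , inj₂ (A ++ B , refl , pal)

CentralForm : (ℕ → Move) → ℕ → Set
CentralForm R n = ∃ λ A → ∃ λ B → (pairs R n ≡ (a ∷ A , B ++ [ b ])) × Central A B

centralForm : ∀ R n → CentralForm R n
centralForm R zero = [] , [] , refl , refl , inj₁ refl , inj₁ refl
centralForm R (suc n) with centralForm R n
... | A , B , e , central rewrite e with R n
... | U = (A ++ B) ++ [ b ] , B , cong (λ z → (a ∷ z , B ++ [ b ])) (sym (++-assoc A B [ b ])) , central-U A B central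
... | V = A , a ∷ (A ++ B) , cong (λ z → (a ∷ A , a ∷ z)) (sym (++-assoc A B [ b ])) , central-V A B central

Comparable : Word → Word → Set
Comparable X Y = ∃ λ Z → (X ++ Z ≡ Y) ⊎ (Y ++ Z ≡ X)

comparable-sym : ∀ {X Y} → Comparable X Y → Comparable Y X
comparable-sym (Z , inj₁ e) = Z , inj₂ e
comparable-sym (Z , inj₂ e) = Z , inj₁ e

comparable-++ : ∀ X Y {X′ Y′} → X ++ X′ ≡ Y ++ Y′ → Comparable X Y
comparable-++ []      Y       e = Y , inj₁ refl
comparable-++ (x ∷ X) []      e = x ∷ X , inj₂ refl
comparable-++ (x ∷ X) (y ∷ Y) e with ∷-injective e
... | refl , e′ with comparable-++ X Y e′
... | Z , inj₁ e″ = Z , inj₁ (cong (x ∷_) e″)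
... | Z , inj₂ e″ = Z , inj₂ (cong (x ∷_) e″)

comparable-palindrome : ∀ A B → Palindrome (A ++ B) → Comparable (reverse B) A
comparable-palindrome A B pal = comparable-++ (reverse B) A (trans (sym (reverse-++ A B)) pal)

digit : AB → Digit
digit a = two
digit b = one

toDigits-∷ : ∀ x w → toDigits (x ∷ w) ≡ digit x ∷ digit x ∷ toDigits w
toDigits-∷ a w = refl
toDigits-∷ b w = refl

toDigits-++ : ∀ u v → toDigits (u ++ v) ≡ toDigits u ++ toDigits v
toDigits-++ = concatMap-++ letter

reverse-toDigits : ∀ w → reverse (toDigits w) ≡ toDigits (reverse w)
reverse-toDigits []      = refl
reverse-toDigits (x ∷ w) = begin
  reverse (toDigits (x ∷ w))                     ≡⟨ cong reverse (toDigits-∷ x w) ⟩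
  reverse ((digit x ∷ digit x ∷ []) ++ toDigits w) ≡⟨ reverse-++ (digit x ∷ digit x ∷ []) (toDigits w) ⟩
  reverse (toDigits w) ++ digit x ∷ digit x ∷ [] ≡⟨ cong₂ _++_ (reverse-toDigits w) (sym (toDigits-∷ x [])) ⟩
  toDigits (reverse w) ++ toDigits [ x ]         ≡⟨ sym (toDigits-++ (reverse w) [ x ]) ⟩
  toDigits (reverse w ++ [ x ])                  ≡⟨ cong toDigits (sym (unfold-reverse x w)) ⟩
  toDigits (reverse (x ∷ w))                     ∎
  where open ≡-Reasoning

length-toDigits : ∀ w → length (toDigits w) ≡ length w + length w
length-toDigits []      = refl
length-toDigits (x ∷ w) rewrite toDigits-∷ x w | length-toDigits w = cong suc (sym (+-suc (length w) (length w)))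

≤length-toDigits : ∀ {M} w → M ≤ length w → M ≤ length (toDigits w)
≤length-toDigits w M≤ = ≤-trans M≤ (≤-trans (m≤m+n (length w) (length w)) (≤-reflexive (sym (length-toDigits w))))

toDigits-uncons : ∀ w {y z v} → toDigits w ≡ y ∷ z ∷ v →
  ∃ λ x → ∃ λ w′ → (w ≡ x ∷ w′) × (digit x ≡ y) × (y ≡ z) × (v ≡ toDigits w′)
toDigits-uncons (a ∷ w) refl = a , w , refl , refl , refl , refl
toDigits-uncons (b ∷ w) refl = b , w , refl , refl , refl , refl

NoIsolatedDigit : List Digit → Set
NoIsolatedDigit W = ∀ u x y z v → W ≡ u ++ x ∷ y ∷ z ∷ v → (y ≡ x) ⊎ (y ≡ z)

noIsolatedDigit-toDigits : ∀ w → NoIsolatedDigit (toDigits w)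
noIsolatedDigit-toDigits w [] x y z v e with toDigits-uncons w e
... | _ , _ , _ , _ , x≡y , _ = inj₁ (sym x≡y)
noIsolatedDigit-toDigits w (_ ∷ []) x y z v e with toDigits-uncons w e
... | _ , w′ , _ , _ , _ , e′ with toDigits-uncons w′ (sym e′)
... | _ , _ , _ , _ , y≡z , _ = inj₂ y≡z
noIsolatedDigit-toDigits w (_ ∷ _ ∷ u) x y z v e with toDigits-uncons w e
... | _ , w′ , refl , _ , _ , e′ = noIsolatedDigit-toDigits w′ u x y z v (sym e′)

toDigits-split : ∀ w u {d e} v → ¬ d ≡ e → toDigits w ≡ u ++ d ∷ d ∷ e ∷ e ∷ v →
  ∃ λ w₁ → ∃ λ w₂ → ∃ λ x → ∃ λ y →
    (w ≡ w₁ ++ x ∷ y ∷ w₂) × (digit x ≡ d) × (digit y ≡ e) × (u ≡ toDigits w₁) × (v ≡ toDigits w₂)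
toDigits-split w [] v d≢e eq with toDigits-uncons w eq
... | x , w′ , refl , dx , _ , e′ with toDigits-uncons w′ (sym e′)
... | y , w₂ , refl , dy , _ , e″ = [] , w₂ , x , y , refl , dx , dy , refl , e″
toDigits-split w (_ ∷ []) v d≢e eq with toDigits-uncons w eq
... | _ , w′ , _ , _ , _ , e′ with toDigits-uncons w′ (sym e′)
... | _ , _ , _ , _ , d≡e , _ = ⊥-elim (d≢e d≡e)
toDigits-split w (_ ∷ _ ∷ u) v d≢e eq with toDigits-uncons w eq
... | x , w′ , refl , refl , refl , e′ with toDigits-split w′ u v d≢e (sym e′)
... | w₁ , w₂ , x′ , y , refl , dx , dy , refl , refl =
  x ∷ w₁ , w₂ , x′ , y , refl , dx , dy , sym (toDigits-∷ x w₁) , refl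

≤lex⇒≤cf : ∀ {s t} → s ≤lex t → toDigits s ≤cf toDigits t
≤lex⇒≤cf []≤lex            = []≤
≤lex⇒≤cf ≤lex[]            = ≤[]
≤lex⇒≤cf b<a               = 1<2
≤lex⇒≤cf (∷≤lex {a} s≤t)   = ∷≤ (∷≤′ (≤lex⇒≤cf s≤t))
≤lex⇒≤cf (∷≤lex {b} s≤t)   = ∷≤ (∷≤′ (≤lex⇒≤cf s≤t))

Flanked2211 : List Digit → Set
Flanked2211 W = ∀ u v → W ≡ u ++ two ∷ two ∷ one ∷ one ∷ v → reverse u ≤cf v

Flanked1122 : List Digit → Set
Flanked1122 W = ∀ u v → W ≡ u ++ one ∷ one ∷ two ∷ two ∷ v → v ≤cf reverse u

WellFlankedDigits : List Digit → Set
WellFlankedDigits W = NoIsolatedDigit W × Flanked2211 W × Flanked1122 W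

digit≡two : ∀ {x} → digit x ≡ two → x ≡ a
digit≡two {a} _ = refl

digit≡one : ∀ {x} → digit x ≡ one → x ≡ b
digit≡one {b} _ = refl

two≢one : ¬ two ≡ one
two≢one ()

wellFlankedDigits-toDigits : ∀ w → WellFlanked w → WellFlankedDigits (toDigits w)
wellFlankedDigits-toDigits w (flank-ab , flank-ba) = noIsolatedDigit-toDigits w , flank2211 , flank1122
  where
  flank2211 : Flanked2211 (toDigits w)
  flank2211 u v e with toDigits-split w u v two≢one e
  ... | w₁ , w₂ , x , y , ew , dx , dy , refl , refl
    rewrite digit≡two dx | digit≡one dy | reverse-toDigits w₁ = ≤lex⇒≤cf (flank-ab w₁ w₂ ew)
  flank1122 : Flanked1122 (toDigits w)
  flank1122 u v e with toDigits-split w u v (λ ()) e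
  ... | w₁ , w₂ , x , y , ew , dx , dy , refl , refl
    rewrite digit≡one dx | digit≡two dy | reverse-toDigits w₁ = ≤lex⇒≤cf (flank-ba w₁ w₂ ew)

++-reverse-++ : ∀ (u P L T : List Digit) → u ++ (reverse (P ++ L) ++ T) ≡ (u ++ reverse L) ++ (reverse P ++ T)
++-reverse-++ u P L T = begin
  u ++ (reverse (P ++ L) ++ T)           ≡⟨ cong (λ z → u ++ (z ++ T)) (reverse-++ P L) ⟩
  u ++ ((reverse L ++ reverse P) ++ T)   ≡⟨ cong (u ++_) (++-assoc (reverse L) (reverse P) T) ⟩
  u ++ (reverse L ++ (reverse P ++ T))   ≡⟨ sym (++-assoc u (reverse L) (reverse P ++ T)) ⟩
  (u ++ reverse L) ++ (reverse P ++ T)   ∎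
  where open ≡-Reasoning

reverse-++-reverse : ∀ (u L : List Digit) → reverse (u ++ reverse L) ≡ L ++ reverse u
reverse-++-reverse u L = trans (reverse-++ u (reverse L)) (cong (_++ reverse u) (reverse-involutive L))

module _ {W : List Digit} (flanked : WellFlankedDigits W) where

  private
    noIsolated = proj₁ flanked
    flank2211  = proj₁ (proj₂ flanked)
    flank1122  = proj₂ (proj₂ flanked)

  window-22|11 : ∀ u v L R n → W ≡ u ++ (reverse (one ∷ one ∷ L) ++ (two ∷ two ∷ R ++ v)) →
                 length R ≤ length L → suc n ≤ length R ∸ 1 → Value≤3+ n (two ∷ two ∷ R) (one ∷ one ∷ L)
  window-22|11 u v L R n e R≤L n< =
    value≤3+ (nearThree-22|11 R L) n (length R) (≤cf⇒excessBound (length R) R≤cfL ≤-refl R≤L) n<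
    where
    R≤cfL : R ≤cf L
    R≤cfL = ≤cf-prefix (subst ((R ++ v) ≤cf_) (reverse-++-reverse u L)
              (flank1122 (u ++ reverse L) (R ++ v) (trans e (++-reverse-++ u (one ∷ one ∷ []) L _))))

  window-211|2 : ∀ u v L R n → W ≡ u ++ (reverse (two ∷ L) ++ (two ∷ one ∷ one ∷ R ++ v)) →
                 length R ≤ length L → suc n ≤ length R ∸ 1 → Value≤3+ n (two ∷ one ∷ one ∷ R) (two ∷ L)
  window-211|2 u v L R n e R≤L n< =
    value≤3+ (nearThree-211|2 L R) n (length R) (≤cf⇒excessBound (length R) L≤cfR R≤L ≤-refl) n<
    where
    L≤cfR : L ≤cf R
    L≤cfR = ≤cf-prefix (subst (_≤cf (R ++ v)) (reverse-++-reverse u L)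
              (flank2211 (u ++ reverse L) (R ++ v) (trans e (++-reverse-++ u [ two ] L _))))

  -- Unless the value is at most 3 outright, the absence of isolated digits forces the
  -- centre of the window to be 11|22 or 2|211.
  window≤3+ : ∀ u v L R k n → W ≡ u ++ (reverse L ++ (R ++ v)) →
              length L ≡ suc k → length R ≡ suc k → suc n ≤ k ∸ 3 → Value≤3+ n R L
  window≤3+ _ _ L (one ∷ R) _ n _ _ _ _ = value≤3⇒value≤3+ n (one ∷ R) L (value≤3-1∷ R L)
  window≤3+ _ _ (two ∷ L) (two ∷ two ∷ R) _ n _ _ _ _ =
    value≤3⇒value≤3+ n (two ∷ two ∷ R) (two ∷ L) (value≤3-22|2 R L)
  window≤3+ u v (one ∷ l₂ ∷ L) (two ∷ two ∷ R) .(suc (length R)) n e |L| refl n<k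
    with noIsolated (u ++ reverse L) l₂ one two (two ∷ R ++ v) (trans e (++-reverse-++ u (one ∷ l₂ ∷ []) L _))
  ... | inj₁ refl = window-22|11 u v L R n e (≤-reflexive (sym (suc-injective (suc-injective |L|))))
                      (≤-trans n<k (∸-monoʳ-≤ (length R) (s≤s (z≤n {1}))))
  ... | inj₂ ()
  window≤3+ u v (l₁ ∷ L) (two ∷ one ∷ r₂ ∷ R) .(suc (suc (length R))) n e |L| refl n<k
    with noIsolated (u ++ reverse L) l₁ two one (r₂ ∷ R ++ v) (trans e (++-reverse-++ u [ l₁ ] L _))
  ... | inj₂ ()
  ... | inj₁ refl
    with noIsolated ((u ++ reverse L) ++ [ two ]) two one r₂ (R ++ v)
           (trans e (trans (++-reverse-++ u [ two ] L _) (sym (++-assoc (u ++ reverse L) [ two ] _))))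
  ... | inj₁ ()
  ... | inj₂ refl = window-211|2 u v L R n e
                      (subst (length R ≤_) (sym (suc-injective |L|)) (≤-trans (n≤1+n _) (n≤1+n _))) n<k
  window≤3+ _ _ _          []                _ _ _ _  ()   _
  window≤3+ _ _ _          (two ∷ [])        _ _ _ _  refl ()
  window≤3+ _ _ _          (two ∷ one ∷ [])  _ _ _ _  refl ()
  window≤3+ _ _ []         (two ∷ two ∷ _)   _ _ _ () _    _
  window≤3+ _ _ (one ∷ []) (two ∷ two ∷ _)   _ _ _ () refl _

applyUpTo-cong : ∀ {f g : ℕ → Digit} m → (∀ j → f j ≡ g j) → applyUpTo f m ≡ applyUpTo g m
applyUpTo-cong zero    f≗g = refl
applyUpTo-cong (suc m) f≗g = cong₂ _∷_ (f≗g 0) (applyUpTo-cong m (λ j → f≗g (suc j)))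

segment : BiWord → ℤ → ℕ → List Digit
segment ω c m = applyUpTo (λ j → ω (c ℤ.+ + j)) m

segment-suc : ∀ ω c m → segment ω c (suc m) ≡ ω c ∷ segment ω (c ℤ.+ + 1) m
segment-suc ω c m = cong₂ _∷_ (cong ω (ℤP.+-identityʳ c))
  (applyUpTo-cong m (λ j → cong ω (sym (ℤP.+-assoc c (+ 1) (+ j)))))

segment-++ : ∀ ω c m m′ → segment ω c (m + m′) ≡ segment ω c m ++ segment ω (c ℤ.+ + m) m′
segment-++ ω c zero    m′ = applyUpTo-cong m′ (λ j → cong ω (cong (ℤ._+ + j) (sym (ℤP.+-identityʳ c))))
segment-++ ω c (suc m) m′ = begin
  segment ω c (suc (m + m′))                                      ≡⟨ segment-suc ω c (m + m′) ⟩
  ω c ∷ segment ω (c ℤ.+ + 1) (m + m′)                            ≡⟨ cong (ω c ∷_) (segment-++ ω (c ℤ.+ + 1) m m′) ⟩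
  ω c ∷ (segment ω (c ℤ.+ + 1) m ++ segment ω ((c ℤ.+ + 1) ℤ.+ + m) m′)
    ≡⟨ cong (λ z → ω c ∷ (segment ω (c ℤ.+ + 1) m ++ segment ω z m′)) (ℤP.+-assoc c (+ 1) (+ m)) ⟩
  ω c ∷ (segment ω (c ℤ.+ + 1) m ++ segment ω (c ℤ.+ + suc m) m′)
    ≡⟨ cong (_++ segment ω (c ℤ.+ + suc m) m′) (sym (segment-suc ω c m)) ⟩
  segment ω c (suc m) ++ segment ω (c ℤ.+ + suc m) m′             ∎
  where open ≡-Reasoning

-+-cancel : ∀ c x → (c ℤ.- x) ℤ.+ x ≡ c
-+-cancel = solve 2 (λ c x → (c :- x) :+ x := c) refl
  where open ℤ-Solver.+-*-Solver

reverse-segment-left : ∀ ω c m → reverse (applyUpTo (λ j → ω (c ℤ.- + suc j)) m) ≡ segment ω (c ℤ.- + m) m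
reverse-segment-left ω c zero    = refl
reverse-segment-left ω c (suc m) = begin
  reverse (applyUpTo g (suc m))           ≡⟨ cong reverse (sym (applyUpTo-∷ʳ g m)) ⟩
  reverse (applyUpTo g m ++ [ g m ])      ≡⟨ reverse-++ (applyUpTo g m) [ g m ] ⟩
  g m ∷ reverse (applyUpTo g m)           ≡⟨ cong (g m ∷_) (reverse-segment-left ω c m) ⟩
  g m ∷ segment ω (c ℤ.- + m) m           ≡⟨ cong (λ z → g m ∷ segment ω z m) (sym (step c m)) ⟩
  g m ∷ segment ω ((c ℤ.- + suc m) ℤ.+ + 1) m ≡⟨ sym (segment-suc ω (c ℤ.- + suc m) m) ⟩
  segment ω (c ℤ.- + suc m) (suc m)       ∎
  where
  open ≡-Reasoning
  g = λ j → ω (c ℤ.- + suc j)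
  step : ∀ c m → (c ℤ.- (+ 1 ℤ.+ + m)) ℤ.+ + 1 ≡ c ℤ.- + m
  step c m = solve 2 (λ c x → (c :- (con (+ 1) :+ x)) :+ con (+ 1) := c :- x) refl c (+ m)
    where open ℤ-Solver.+-*-Solver

rightWindow-shift : ∀ ω n k → rightWindow (shift n ω) k ≡ segment ω (ℤ.- n) (suc k)
rightWindow-shift ω n k = applyUpTo-cong (suc k) (λ j → cong ω (ℤP.+-comm (+ j) (ℤ.- n)))

reverse-leftWindow-shift : ∀ ω n k → reverse (leftWindow (shift n ω) k) ≡ segment ω (ℤ.- n ℤ.- + suc k) (suc k)
reverse-leftWindow-shift ω n k =
  trans (cong reverse (applyUpTo-cong (suc k) (λ j → cong ω (ℤP.+-comm -[1+ j ] (ℤ.- n)))))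
        (reverse-segment-left ω (ℤ.- n) (suc k))

reverse-leftPrefix-++-rightPrefix : ∀ ω K → reverse (leftPrefix ω K) ++ rightPrefix ω K ≡ segment ω (ℤ.- + K) (K + K)
reverse-leftPrefix-++-rightPrefix ω K = begin
  reverse (leftPrefix ω K) ++ rightPrefix ω K
    ≡⟨ cong₂ (λ x y → reverse x ++ y) (map-upTo (λ j → ω -[1+ j ]) K) (map-upTo (λ j → ω (+ j)) K) ⟩
  reverse (applyUpTo (λ j → ω -[1+ j ]) K) ++ segment ω (+ 0) K
    ≡⟨ cong (λ x → reverse x ++ segment ω (+ 0) K) (applyUpTo-cong K (λ j → cong ω (sym (ℤP.+-identityˡ -[1+ j ])))) ⟩
  reverse (applyUpTo (λ j → ω (+ 0 ℤ.- + suc j)) K) ++ segment ω (+ 0) K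
    ≡⟨ cong (_++ segment ω (+ 0) K) (reverse-segment-left ω (+ 0) K) ⟩
  segment ω (+ 0 ℤ.- + K) K ++ segment ω (+ 0) K
    ≡⟨ cong₂ (λ x y → segment ω x K ++ segment ω y K) (ℤP.+-identityˡ (ℤ.- + K)) (sym (ℤP.+-inverseˡ (+ K))) ⟩
  segment ω (ℤ.- + K) K ++ segment ω (ℤ.- + K ℤ.+ + K) K
    ≡⟨ sym (segment-++ ω (ℤ.- + K) K K) ⟩
  segment ω (ℤ.- + K) (K + K) ∎
  where open ≡-Reasoning

block-occurs : ∀ ω K (P Q : List Digit) → IsPrefix (rightPrefix ω K) Q → IsPrefix (leftPrefix ω K) (reverse P) →
  ∃ λ X → ∃ λ Y → (P ++ Q ≡ X ++ (segment ω (ℤ.- + K) (K + K) ++ Y)) × (length P ≡ length X + K)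
block-occurs ω K P Q (Y , eQ) (X′ , eP) = reverse X′ , Y , occurs , lengthP
  where
  open ≡-Reasoning
  LP = leftPrefix ω K
  RP = rightPrefix ω K
  P≡ : P ≡ reverse X′ ++ reverse LP
  P≡ = trans (sym (reverse-involutive P)) (trans (cong reverse (sym eP)) (reverse-++ LP X′))
  occurs : P ++ Q ≡ reverse X′ ++ (segment ω (ℤ.- + K) (K + K) ++ Y)
  occurs = begin
    P ++ Q                                    ≡⟨ cong₂ _++_ P≡ (sym eQ) ⟩
    (reverse X′ ++ reverse LP) ++ (RP ++ Y)   ≡⟨ ++-assoc (reverse X′) (reverse LP) (RP ++ Y) ⟩
    reverse X′ ++ (reverse LP ++ (RP ++ Y))   ≡⟨ cong (reverse X′ ++_) (sym (++-assoc (reverse LP) RP Y)) ⟩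
    reverse X′ ++ ((reverse LP ++ RP) ++ Y)
      ≡⟨ cong (λ z → reverse X′ ++ (z ++ Y)) (reverse-leftPrefix-++-rightPrefix ω K) ⟩
    reverse X′ ++ (segment ω (ℤ.- + K) (K + K) ++ Y) ∎
  lengthP : length P ≡ length (reverse X′) + K
  lengthP = trans (cong length P≡) (trans (length-++ (reverse X′)) (cong (λ z → length (reverse X′) + z)
              (trans (length-reverse LP) (trans (length-map _ (upTo K)) (length-upTo K)))))

-- The block ω₋ₖ … ωₖ₋₁ splits into d digits, the window of radius s around position −n,
-- and r digits.
record Placement (n : ℤ) (s : ℕ) : Set where
  field
    K d r    : ℕ
    total    : K + K ≡ d + (s + (s + r))
    start    : ℤ.- + K ℤ.+ + d ≡ ℤ.- n ℤ.- + s
    position : ∀ p → n ≡ + p → d + s + p ≡ K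

-[q+t]+[q+q]≡q-t : ∀ q t → ℤ.- (q ℤ.+ t) ℤ.+ (q ℤ.+ q) ≡ q ℤ.- t
-[q+t]+[q+q]≡q-t = solve 2 (λ q t → :- (q :+ t) :+ (q :+ q) := q :- t) refl
  where open ℤ-Solver.+-*-Solver

placement : ∀ n s → Placement n s
placement (+ p) s = record
  { K = p + s ; d = 0 ; r = p + p
  ; total    = solve 2 (λ p s → (p :+ s) :+ (p :+ s) := con 0 :+ (s :+ (s :+ (p :+ p)))) refl p s
  ; start    = trans (ℤP.+-identityʳ _) (ℤP.neg-distrib-+ (+ p) (+ s))
  ; position = λ { p′ refl → +-comm s p }
  }
  where open +-*-Solver
placement -[1+ p ] s = record
  { K = suc p + s ; d = suc p + suc p ; r = 0
  ; total    = solve 2 (λ p s → (p :+ s) :+ (p :+ s) := (p :+ p) :+ (s :+ (s :+ con 0))) refl (suc p) s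
  ; start    = -[q+t]+[q+q]≡q-t (+ suc p) (+ s)
  ; position = λ _ ()
  }
  where open +-*-Solver

segment-placement : ∀ ω n k (pl : Placement n (suc k)) → let open Placement pl in
  segment ω (ℤ.- + K) (K + K)
    ≡ segment ω (ℤ.- + K) d
      ++ (reverse (leftWindow (shift n ω) k) ++ (rightWindow (shift n ω) k ++ segment ω (ℤ.- n ℤ.+ + suc k) r))
segment-placement ω n k pl = begin
  segment ω (ℤ.- + K) (K + K)                                  ≡⟨ cong (segment ω (ℤ.- + K)) total ⟩
  segment ω (ℤ.- + K) (d + (s + (s + r)))                      ≡⟨ segment-++ ω (ℤ.- + K) d _ ⟩
  D ++ segment ω (ℤ.- + K ℤ.+ + d) (s + (s + r))               ≡⟨ cong (λ z → D ++ segment ω z (s + (s + r))) start ⟩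
  D ++ segment ω (c ℤ.- + s) (s + (s + r))                     ≡⟨ cong (D ++_) (segment-++ ω (c ℤ.- + s) s (s + r)) ⟩
  D ++ (A ++ segment ω ((c ℤ.- + s) ℤ.+ + s) (s + r))
    ≡⟨ cong (λ z → D ++ (A ++ segment ω z (s + r))) (-+-cancel c (+ s)) ⟩
  D ++ (A ++ segment ω c (s + r))                              ≡⟨ cong (λ z → D ++ (A ++ z)) (segment-++ ω c s r) ⟩
  D ++ (A ++ (segment ω c s ++ C))
    ≡⟨ cong₂ (λ x y → D ++ (x ++ (y ++ C))) (sym (reverse-leftWindow-shift ω n k)) (sym (rightWindow-shift ω n k)) ⟩
  D ++ (reverse (leftWindow (shift n ω) k) ++ (rightWindow (shift n ω) k ++ C)) ∎
  where
  open ≡-Reasoning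
  open Placement pl
  s = suc k
  c = ℤ.- n
  D = segment ω (ℤ.- + K) d
  A = segment ω (c ℤ.- + s) s
  C = segment ω (c ℤ.+ + s) r

++-reassoc : ∀ (X D A B C Y : List Digit) → X ++ ((D ++ (A ++ (B ++ C))) ++ Y) ≡ (X ++ D) ++ (A ++ (B ++ (C ++ Y)))
++-reassoc X D A B C Y = begin
  X ++ ((D ++ (A ++ (B ++ C))) ++ Y)   ≡⟨ cong (X ++_) (++-assoc D (A ++ (B ++ C)) Y) ⟩
  X ++ (D ++ ((A ++ (B ++ C)) ++ Y))   ≡⟨ cong (λ z → X ++ (D ++ z)) (++-assoc A (B ++ C) Y) ⟩
  X ++ (D ++ (A ++ ((B ++ C) ++ Y)))   ≡⟨ cong (λ z → X ++ (D ++ (A ++ z))) (++-assoc B C Y) ⟩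
  X ++ (D ++ (A ++ (B ++ (C ++ Y))))   ≡⟨ sym (++-assoc X D _) ⟩
  (X ++ D) ++ (A ++ (B ++ (C ++ Y)))   ∎
  where open ≡-Reasoning

window-occurs : ∀ (w : ℕ → Marked) ω → ConvergesTo w ω → ∀ n k → ∃ λ I → ∀ i → I ≤ i →
  ∃ λ u → ∃ λ v →
    (proj₁ (w i) ++ proj₂ (w i) ≡ u ++ (reverse (leftWindow (shift n ω) k) ++ (rightWindow (shift n ω) k ++ v)))
  × (∀ p → n ≡ + p → length u + suc k + p ≡ length (proj₁ (w i)))
window-occurs w ω conv n k with conv (Placement.K (placement n (suc k)))
... | I , prefixes = I , λ i I≤i → occurs (proj₁ (w i)) (proj₂ (w i)) (prefixes i I≤i)
  where
  open Placement (placement n (suc k))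
  D = segment ω (ℤ.- + K) d
  C = segment ω (ℤ.- n ℤ.+ + suc k) r
  occurs : ∀ P Q → IsPrefix (rightPrefix ω K) Q × IsPrefix (leftPrefix ω K) (reverse P) →
    ∃ λ u → ∃ λ v →
      (P ++ Q ≡ u ++ (reverse (leftWindow (shift n ω) k) ++ (rightWindow (shift n ω) k ++ v)))
    × (∀ p → n ≡ + p → length u + suc k + p ≡ length P)
  occurs P Q (onRight , onLeft) with block-occurs ω K P Q onRight onLeft
  ... | X , Y , eW , lengthP =
      X ++ D , C ++ Y
    , trans eW (trans (cong (λ z → X ++ (z ++ Y)) (segment-placement ω n k (placement n (suc k))))
                      (++-reassoc X D (reverse (leftWindow (shift n ω) k)) (rightWindow (shift n ω) k) C Y))
    , λ p n≡p → begin
        length (X ++ D) + suc k + p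
          ≡⟨ cong (λ z → z + suc k + p) (trans (length-++ X) (cong (λ z → length X + z) (length-applyUpTo _ d))) ⟩
        length X + d + suc k + p
          ≡⟨ trans (+-assoc (length X + d) (suc k) p) (+-assoc (length X) d (suc k + p)) ⟩
        length X + (d + (suc k + p))
          ≡⟨ cong (λ z → length X + z) (trans (sym (+-assoc d (suc k) p)) (position p n≡p)) ⟩
        length X + K                    ≡⟨ sym lengthP ⟩
        length P                        ∎
    where open ≡-Reasoning

-- The right and left parts of a window centred at 11|22 or at 2|211, whose flanks read
-- outwards from the centre agree on M digits.
data Centred (M : ℕ) : List Digit → List Digit → Set where
  centred-22|11 : ∀ c X Y → M ≤ length c → Centred M (two ∷ two ∷ c ++ X) (one ∷ one ∷ c ++ Y)
  centred-211|2 : ∀ c X Y → M ≤ length c → Centred M (two ∷ one ∷ one ∷ c ++ Y) (two ∷ c ++ X)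

common-prefix : ∀ M (X Y c : List Digit) {A B Z₁ Z₂} → X ++ A ≡ c ++ Z₁ → Y ++ B ≡ c ++ Z₂ →
  M ≤ length c → M ≤ length X → M ≤ length Y →
  ∃ λ c′ → ∃ λ X₀ → ∃ λ Y₀ → (X ≡ c′ ++ X₀) × (Y ≡ c′ ++ Y₀) × (length c′ ≡ M)
common-prefix zero X Y c _ _ _ _ _ = [] , X , Y , refl , refl , refl
common-prefix (suc M) (x ∷ X) (_ ∷ Y) (_ ∷ c) eX eY (s≤s M≤c) (s≤s M≤X) (s≤s M≤Y)
  with ∷-injective eX | ∷-injective eY
... | refl , eX′ | refl , eY′ with common-prefix M X Y c eX′ eY′ M≤c M≤X M≤Y
... | c′ , X₀ , Y₀ , refl , refl , refl = x ∷ c′ , X₀ , Y₀ , refl , refl , refl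

centred-window : ∀ {M R L} → Centred M R L → ∀ Rw Lw {A B} n → Rw ++ A ≡ R → Lw ++ B ≡ L →
  3 + M ≤ length Rw → 3 + M ≤ length Lw → suc n ≤ M ∸ 1 → Value≥3- n Rw Lw
centred-window {M} (centred-22|11 c X Y M≤c) (_ ∷ _ ∷ Rw) (_ ∷ _ ∷ Lw) n eR eL (s≤s (s≤s M<Rw)) (s≤s (s≤s M<Lw)) n<M
  with ∷-injective eR | ∷-injective eL
... | refl , eR′ | refl , eL′ with ∷-injective eR′ | ∷-injective eL′
... | refl , eR″ | refl , eL″ with common-prefix M Rw Lw c eR″ eL″ M≤c (<⇒≤ M<Rw) (<⇒≤ M<Lw)
... | c′ , X₀ , Y₀ , refl , refl , refl =
  value≥3- (nearThree-22|11 (c′ ++ X₀) (c′ ++ Y₀)) n (length c′) (excessBound-++ c′ Y₀ X₀) n<M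
centred-window {M} (centred-211|2 c X Y M≤c) (_ ∷ _ ∷ _ ∷ Rw) (_ ∷ Lw) n eR eL (s≤s (s≤s (s≤s M≤Rw))) (s≤s M+2≤Lw) n<M
  with ∷-injective eR | ∷-injective eL
... | refl , eR′ | refl , eL′ with ∷-injective eR′
... | refl , eR″ with ∷-injective eR″
... | refl , eR‴ with common-prefix M Rw Lw c eR‴ eL′ M≤c M≤Rw (≤-trans (m≤n+m M 2) M+2≤Lw)
... | c′ , X₀ , Y₀ , refl , refl , refl =
  value≥3- (nearThree-211|2 (c′ ++ Y₀) (c′ ++ X₀)) n (length c′) (excessBound-++ c′ X₀ Y₀) n<M
centred-window (centred-22|11 _ _ _ _) []                _           _ _ _ ()                _ _
centred-window (centred-22|11 _ _ _ _) (_ ∷ [])          _           _ _ _ (s≤s ())          _ _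
centred-window (centred-22|11 _ _ _ _) (_ ∷ _ ∷ _)       []          _ _ _ _ ()                _
centred-window (centred-22|11 _ _ _ _) (_ ∷ _ ∷ _)       (_ ∷ [])    _ _ _ _ (s≤s ())          _
centred-window (centred-211|2 _ _ _ _) []                _           _ _ _ ()                _ _
centred-window (centred-211|2 _ _ _ _) (_ ∷ [])          _           _ _ _ (s≤s ())          _ _
centred-window (centred-211|2 _ _ _ _) (_ ∷ _ ∷ [])      _           _ _ _ (s≤s (s≤s ()))    _ _
centred-window (centred-211|2 _ _ _ _) (_ ∷ _ ∷ _ ∷ _)   []          _ _ _ _ ()                _

CentredAt : ℕ → ℕ → Marked → Set
CentredAt p M (P , Q) = ∃ λ L → ∃ λ R → (P ++ Q ≡ reverse L ++ R) × (length L + p ≡ length P) × Centred M R L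

EventuallyCentredAt : (ℕ → Marked) → ℕ → ℕ → Set
EventuallyCentredAt w p M = ∃ λ I₀ → ∀ i → I₀ ≤ i → CentredAt p M (w i)

++-split : ∀ {A : Set} (xs xs′ : List A) {ys ys′} → xs ++ ys ≡ xs′ ++ ys′ → length xs ≡ length xs′ →
  (xs ≡ xs′) × (ys ≡ ys′)
++-split []       []        e _ = refl , e
++-split []       (_ ∷ _)   e ()
++-split (_ ∷ _)  []        e ()
++-split (_ ∷ xs) (_ ∷ xs′) e l with ∷-injective e
... | refl , e′ with ++-split xs xs′ e′ (suc-injective l)
... | refl , e″ = refl , e″

reverse-++-split : ∀ (u Lw L : List Digit) → u ++ reverse Lw ≡ reverse L → Lw ++ reverse u ≡ L
reverse-++-split u Lw L e = begin
  Lw ++ reverse u                      ≡⟨ sym (reverse-++-reverse u Lw) ⟩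
  reverse (u ++ reverse Lw)            ≡⟨ cong reverse e ⟩
  reverse (reverse L)                  ≡⟨ reverse-involutive L ⟩
  L                                    ∎
  where open ≡-Reasoning

p≤p+ε : ∀ p {ε} → 0ℚᵘ ℚ.< ε → p ℚ.≤ p ℚ.+ ε
p≤p+ε p {ε} ε>0 = ℚP.p≤p+q p ε {{ℚ.nonNegative (ℚP.<⇒≤ ε>0)}}

p-ε≤p : ∀ p {ε} → 0ℚᵘ ℚ.< ε → p ℚ.- ε ℚ.≤ p
p-ε≤p p {ε} ε>0 = begin
  p ℚ.- ε        ≤⟨ ℚP.+-monoʳ-≤ p (ℚP.neg-mono-≤ (ℚP.<⇒≤ ε>0)) ⟩
  p ℚ.+ 0ℚᵘ      ≃⟨ ℚP.+-identityʳ p ⟩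
  p              ∎
  where open ℚP.≤-Reasoning

≤+⇒-≤ : ∀ {c x e ε} → c ℚ.≤ x ℚ.+ e → e ℚ.≤ ε → c ℚ.- ε ℚ.≤ x
≤+⇒-≤ {c} {x} {e} {ε} c≤x+e e≤ε = begin
  c ℚ.- ε                ≤⟨ ℚP.+-monoʳ-≤ c (ℚP.neg-mono-≤ e≤ε) ⟩
  c ℚ.- e                ≤⟨ ℚP.+-monoˡ-≤ (ℚ.- e) c≤x+e ⟩
  (x ℚ.+ e) ℚ.- e        ≃⟨ ℚP.+-assoc x e (ℚ.- e) ⟩
  x ℚ.+ (e ℚ.- e)        ≃⟨ ℚP.+-congʳ x (ℚP.+-inverseʳ e) ⟩
  x ℚ.+ 0ℚᵘ              ≃⟨ ℚP.+-identityʳ x ⟩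
  x                      ∎
  where open ℚP.≤-Reasoning

lamLe-mono : ∀ {y c c′} → c ℚ.≤ c′ → LamLe y c → LamLe y c′
lamLe-mono c≤c′ le ε ε>0 with le ε ε>0
... | K , bound = K , λ k K≤k → ℚP.≤-trans (bound k K≤k) (ℚP.+-monoˡ-≤ ε c≤c′)

module _ (w : ℕ → Marked) (ω : BiWord) (conv : ConvergesTo w ω) where

  flanked-lamApprox≤ : (∀ i → WellFlankedDigits (proj₁ (w i) ++ proj₂ (w i))) →
    ∀ n N k → 4 + N ≤ k → lamApprox (shift n ω) k ℚ.≤ three ℚ.+ 1/[1+ N ]
  flanked-lamApprox≤ flanked n N k N+4≤k with window-occurs w ω conv n k
  ... | I , occurs with occurs I ≤-refl
  ... | u , v , eW , _ =
    value≤3+⇒lamApprox≤ (shift n ω) k N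
      (window≤3+ (flanked I) u v (leftWindow (shift n ω) k) (rightWindow (shift n ω) k) k N eW
        (length-leftWindow (shift n ω) k) (length-rightWindow (shift n ω) k) (∸-monoˡ-≤ 3 N+4≤k))

  lamLe-3 : (∀ i → WellFlankedDigits (proj₁ (w i) ++ proj₂ (w i))) → ∀ n → LamLe (shift n ω) three
  lamLe-3 flanked n ε ε>0 with archimedean ε ε>0
  ... | N , 1/N≤ε = 4 + N , λ k N+4≤k →
    ℚP.≤-trans (flanked-lamApprox≤ flanked n N k N+4≤k) (ℚP.+-monoʳ-≤ three 1/N≤ε)

  centred-lamApprox≥ : ∀ p M → EventuallyCentredAt w p M →
    ∀ N → suc N ≤ M ∸ 1 → ∀ k → 2 + M ≤ k → three ℚ.≤ lamApprox (shift (+ p) ω) k ℚ.+ 1/[1+ N ]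
  centred-lamApprox≥ p M (I₀ , centred) N N<M k M+2≤k with window-occurs w ω conv (+ p) k
  ... | I , occurs with occurs (I + I₀) (m≤m+n I I₀) | centred (I + I₀) (m≤n+m I₀ I)
  ... | u , v , eW , position | L , R , eW′ , position′ , centre =
    value≥3-⇒lamApprox≥ (shift (+ p) ω) k N
      (centred-window centre Rw Lw N (proj₂ split) (reverse-++-split u Lw L (proj₁ split))
        (≤-trans (s≤s M+2≤k) (≤-reflexive (sym |Rw|))) (≤-trans (s≤s M+2≤k) (≤-reflexive (sym |Lw|))) N<M)
    where
    Rw = rightWindow (shift (+ p) ω) k
    Lw = leftWindow (shift (+ p) ω) k
    |Rw| = length-rightWindow (shift (+ p) ω) k
    |Lw| = length-leftWindow (shift (+ p) ω) k
    split : (u ++ reverse Lw ≡ reverse L) × (Rw ++ v ≡ R)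
    split = ++-split (u ++ reverse Lw) (reverse L)
      (trans (++-assoc u (reverse Lw) (Rw ++ v)) (trans (sym eW) eW′))
      (begin
        length (u ++ reverse Lw)       ≡⟨ length-++ u ⟩
        length u + length (reverse Lw) ≡⟨ cong (λ z → length u + z) (trans (length-reverse Lw) |Lw|) ⟩
        length u + suc k               ≡⟨ +-cancelʳ-≡ p _ _ (trans (position p refl) (sym position′)) ⟩
        length L                       ≡⟨ sym (length-reverse L) ⟩
        length (reverse L)             ∎)
      where open ≡-Reasoning

  lamGe-3-ε : ∀ p ε N → 1/[1+ N ] ℚ.≤ ε → EventuallyCentredAt w p (2 + N) → LamGe (shift (+ p) ω) (three ℚ.- ε)
  lamGe-3-ε p ε N 1/N≤ε centred ε′ ε′>0 = 4 + N , λ k N+4≤k →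
    ℚP.≤-trans (p-ε≤p (three ℚ.- ε) ε′>0) (≤+⇒-≤ (centred-lamApprox≥ p (2 + N) centred N ≤-refl k N+4≤k) 1/N≤ε)

-- the j-th digit of a word, with junk value one past its end
at : List Digit → ℕ → Digit
at []       _       = one
at (x ∷ xs) zero    = x
at (x ∷ xs) (suc j) = at xs j

at-++ : ∀ xs ys j → suc j ≤ length xs → at (xs ++ ys) j ≡ at xs j
at-++ (x ∷ xs) ys zero    _         = refl
at-++ (x ∷ xs) ys (suc j) (s≤s j<) = at-++ xs ys j j<

limit : (s : ℕ → List Digit) → Unbounded s → ℕ → Digit
limit s unbounded j = at (s (proj₁ (unbounded (suc j)))) j

limit-at : ∀ {s} → Growing s → (unbounded : Unbounded s) → ∀ j i → suc j ≤ length (s i) →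
  limit s unbounded j ≡ at (s i) j
limit-at {s} grow unbounded j i j<i with unbounded (suc j)
... | i₀ , j<i₀ with growing-≤ grow (m≤m+n i₀ i) | growing-≤ grow (m≤n+m i i₀)
... | Z₀ , e₀ | Z , e = begin
  at (s i₀) j              ≡⟨ sym (at-++ (s i₀) Z₀ j j<i₀) ⟩
  at (s i₀ ++ Z₀) j        ≡⟨ cong (λ z → at z j) (trans (sym e₀) e) ⟩
  at (s i ++ Z) j          ≡⟨ at-++ (s i) Z j j<i ⟩
  at (s i) j               ∎
  where open ≡-Reasoning

applyUpTo-prefix : ∀ k (f : ℕ → Digit) xs → k ≤ length xs → (∀ j → suc j ≤ k → f j ≡ at xs j) →
  IsPrefix (applyUpTo f k) xs
applyUpTo-prefix zero    f xs       _        _  = xs , refl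
applyUpTo-prefix (suc k) f (x ∷ xs) (s≤s k≤) f≡
  with applyUpTo-prefix k (λ j → f (suc j)) xs k≤ (λ j j< → f≡ (suc j) (s≤s j<))
... | t , e = t , cong₂ _∷_ (f≡ 0 (s≤s z≤n)) e

limit-prefix : ∀ {s} → Growing s → (unbounded : Unbounded s) → ∀ k →
  ∃ λ I → ∀ i → I ≤ i → IsPrefix (map (limit s unbounded) (upTo k)) (s i)
limit-prefix {s} grow unbounded k with unbounded k
... | I , k≤ = I , λ i I≤i → subst (λ z → IsPrefix z (s i)) (sym (map-upTo (limit s unbounded) k))
  (applyUpTo-prefix k (limit s unbounded) (s i) (k≤s i I≤i)
    (λ j j<k → limit-at grow unbounded j i (≤-trans j<k (k≤s i I≤i))))
  where
  k≤s : ∀ i → I ≤ i → k ≤ length (s i)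
  k≤s i I≤i = ≤-trans k≤ (length-growing grow I≤i)

converges-growing : ∀ (w : ℕ → Marked) →
  Growing (λ i → proj₂ (w i)) → Unbounded (λ i → proj₂ (w i)) →
  Growing (λ i → reverse (proj₁ (w i))) → Unbounded (λ i → reverse (proj₁ (w i))) →
  ∃ λ ω → ConvergesTo w ω
converges-growing w growR unboundedR growL unboundedL = ω , converges
  where
  ω : BiWord
  ω (+ j)    = limit (λ i → proj₂ (w i)) unboundedR j
  ω -[1+ j ] = limit (λ i → reverse (proj₁ (w i))) unboundedL j
  converges : ConvergesTo w ω
  converges k with limit-prefix growR unboundedR k | limit-prefix growL unboundedL k
  ... | I₁ , right | I₂ , left = I₁ + I₂ , λ i I≤i →
    right i (≤-trans (m≤m+n I₁ I₂) I≤i) , left i (≤-trans (m≤n+m I₂ I₁) I≤i)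

growing-≗ : ∀ {A : Set} {s t : ℕ → List A} → (∀ i → s i ≡ t i) → Growing t → Growing s
growing-≗ s≗t grow i with grow i
... | Z , e = Z , trans (s≗t (suc i)) (trans e (cong (_++ Z) (sym (s≗t i))))

unbounded-≗ : ∀ {A : Set} {s t : ℕ → List A} → (∀ i → s i ≡ t i) → Unbounded t → Unbounded s
unbounded-≗ {t = t} s≗t unbounded L with unbounded L
... | i , L≤ = i , subst (L ≤_) (cong length (sym (s≗t i))) L≤

growing-toDigits : ∀ {s} → Growing s → Growing (λ i → toDigits (s i))
growing-toDigits {s} grow i with grow i
... | Z , e = toDigits Z , trans (cong toDigits e) (toDigits-++ (s i) Z)

unbounded-toDigits : ∀ s → Unbounded s → Unbounded (λ i → toDigits (s i))
unbounded-toDigits s unbounded L with unbounded L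
... | i , L≤ = i , ≤length-toDigits (s i) L≤

unbounded-reverse : ∀ {A : Set} (s : ℕ → List A) → Unbounded s → Unbounded (λ i → reverse (s i))
unbounded-reverse s unbounded L with unbounded L
... | i , L≤ = i , subst (L ≤_) (sym (length-reverse (s i))) L≤

converges-βα : ∀ R → InfinitelyOften R U → InfinitelyOften R V → ∃ λ ω → ConvergesTo (seqβα R) ω
converges-βα R oftenU oftenV = converges-growing (seqβα R)
  (growing-toDigits (α-growing R)) (unbounded-toDigits (α R) (α-unbounded R oftenU))
  (growing-≗ reverse-β (growing-toDigits (reverse-β-growing R)))
  (unbounded-≗ reverse-β (unbounded-toDigits (λ i → reverse (β R i)) (unbounded-reverse (β R) (β-unbounded R oftenV))))
  where
  reverse-β : ∀ i → reverse (toDigits (β R i)) ≡ toDigits (reverse (β R i))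
  reverse-β i = reverse-toDigits (β R i)

converges-αTβT : ∀ R → InfinitelyOften R U → InfinitelyOften R V → ∃ λ ω → ConvergesTo (seqαTβT R) ω
converges-αTβT R oftenU oftenV = converges-growing (seqαTβT R)
  (growing-toDigits (reverse-β-growing R))
  (unbounded-toDigits (λ i → reverse (β R i)) (unbounded-reverse (β R) (β-unbounded R oftenV)))
  (growing-≗ reverse-αT (growing-toDigits (α-growing R)))
  (unbounded-≗ reverse-αT (unbounded-toDigits (α R) (α-unbounded R oftenU)))
  where
  reverse-αT : ∀ i → reverse (toDigits (reverse (α R i))) ≡ toDigits (α R i)
  reverse-αT i = trans (reverse-toDigits (reverse (α R i))) (cong toDigits (reverse-involutive (α R i)))

comparable-toDigits : ∀ {X Y} M → Comparable X Y → M ≤ length X → M ≤ length Y →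
  ∃ λ c → ∃ λ X₀ → ∃ λ Y₀ → (toDigits X ≡ c ++ X₀) × (toDigits Y ≡ c ++ Y₀) × (M ≤ length c)
comparable-toDigits {X} {Y} M (Z , inj₁ refl) M≤X _ =
  toDigits X , [] , toDigits Z , sym (++-identityʳ _) , toDigits-++ X Z , ≤length-toDigits X M≤X
comparable-toDigits {X} {Y} M (Z , inj₂ refl) _ M≤Y =
  toDigits Y , toDigits Z , [] , toDigits-++ Y Z , sym (++-identityʳ _) , ≤length-toDigits Y M≤Y

reverse-++-toDigits : ∀ u X c X₀ → toDigits (reverse X) ≡ c ++ X₀ → reverse (u ++ toDigits X) ≡ c ++ (X₀ ++ reverse u)
reverse-++-toDigits u X c X₀ eX = begin
  reverse (u ++ toDigits X)              ≡⟨ reverse-++ u (toDigits X) ⟩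
  reverse (toDigits X) ++ reverse u      ≡⟨ cong (_++ reverse u) (trans (reverse-toDigits X) eX) ⟩
  (c ++ X₀) ++ reverse u                 ≡⟨ ++-assoc c X₀ (reverse u) ⟩
  c ++ (X₀ ++ reverse u)                 ∎
  where open ≡-Reasoning

reverse-reverse-++ : ∀ (P : List Digit) C T → reverse (C ++ reverse P) ++ T ≡ P ++ (reverse C ++ T)
reverse-reverse-++ P C T = begin
  reverse (C ++ reverse P) ++ T          ≡⟨ cong (_++ T) (reverse-++-reverse C P) ⟩
  (P ++ reverse C) ++ T                  ≡⟨ ++-assoc P (reverse C) T ⟩
  P ++ (reverse C ++ T)                  ∎
  where open ≡-Reasoning

centredAt-1122 : ∀ (P Q u v : List Digit) (X Y : Word) p M →
  P ++ Q ≡ (u ++ toDigits X) ++ one ∷ one ∷ two ∷ two ∷ (toDigits Y ++ v) →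
  2 + length (u ++ toDigits X) + p ≡ length P →
  Comparable (reverse X) Y → M ≤ length X → M ≤ length Y → CentredAt p M (P , Q)
centredAt-1122 P Q u v X Y p M eW position comparable M≤X M≤Y
  with comparable-toDigits M comparable (subst (M ≤_) (sym (length-reverse X)) M≤X) M≤Y
... | c , X₀ , Y₀ , eX , eY , M≤c =
    one ∷ one ∷ reverse (u ++ toDigits X) , two ∷ two ∷ (toDigits Y ++ v)
  , trans eW (sym (reverse-reverse-++ (u ++ toDigits X) (one ∷ one ∷ []) _))
  , trans (cong (λ z → 2 + z + p) (length-reverse (u ++ toDigits X))) position
  , subst₂ (λ R L → Centred M (two ∷ two ∷ R) (one ∷ one ∷ L))
      (sym (trans (cong (_++ v) eY) (++-assoc c Y₀ v))) (sym (reverse-++-toDigits u X c X₀ eX))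
      (centred-22|11 c (Y₀ ++ v) (X₀ ++ reverse u) M≤c)

centredAt-2211 : ∀ (P Q u v : List Digit) (X Y : Word) p M →
  P ++ Q ≡ (u ++ toDigits X) ++ two ∷ two ∷ one ∷ one ∷ (toDigits Y ++ v) →
  1 + length (u ++ toDigits X) + p ≡ length P →
  Comparable (reverse X) Y → M ≤ length X → M ≤ length Y → CentredAt p M (P , Q)
centredAt-2211 P Q u v X Y p M eW position comparable M≤X M≤Y
  with comparable-toDigits M comparable (subst (M ≤_) (sym (length-reverse X)) M≤X) M≤Y
... | c , X₀ , Y₀ , eX , eY , M≤c =
    two ∷ reverse (u ++ toDigits X) , two ∷ one ∷ one ∷ (toDigits Y ++ v)
  , trans eW (sym (reverse-reverse-++ (u ++ toDigits X) [ two ] _))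
  , trans (cong (λ z → 1 + z + p) (length-reverse (u ++ toDigits X))) position
  , subst₂ (λ R L → Centred M (two ∷ one ∷ one ∷ R) (two ∷ L))
      (sym (trans (cong (_++ v) eY) (++-assoc c Y₀ v))) (sym (reverse-++-toDigits u X c X₀ eX))
      (centred-211|2 c (X₀ ++ reverse u) (Y₀ ++ v) M≤c)

LongCentral : (ℕ → Move) → ℕ → ℕ → Set
LongCentral R M n = ∃ λ A → ∃ λ B →
  (pairs R n ≡ (a ∷ A , B ++ [ b ])) × Palindrome (A ++ B) × (M ≤ length A) × (M ≤ length B)

eventually-longCentral : ∀ R → InfinitelyOften R U → InfinitelyOften R V → ∀ M →
  ∃ λ n₀ → ∀ n → n₀ ≤ n → LongCentral R M n
eventually-longCentral R oftenU oftenV M with eventually-long R oftenU oftenV (suc M)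
... | n₀ , long = n₀ , λ n n₀≤n → longCentral n (centralForm R n) (long n n₀≤n)
  where
  longCentral : ∀ n → CentralForm R n → (suc M ≤ length (α R n)) × (suc M ≤ length (β R n)) → LongCentral R M n
  longCentral n (A , B , e , pal , _) (M<α , M<β) rewrite e =
    A , B , refl , pal , ≤-pred M<α , ≤-pred (subst (suc M ≤_) (trans (length-++ B) (+-comm (length B) 1)) M<β)

length-toDigits-++-pair : ∀ (X : Word) d → length (toDigits X ++ d ∷ d ∷ []) ≡ 2 + length (toDigits X)
length-toDigits-++-pair X d = trans (length-++ (toDigits X)) (+-comm (length (toDigits X)) 2)

centred-βα-mark : ∀ R → InfinitelyOften R U → InfinitelyOften R V → ∀ M → EventuallyCentredAt (seqβα R) 0 M
centred-βα-mark R oftenU oftenV M with eventually-longCentral R oftenU oftenV M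
... | n₀ , long = n₀ , λ i n₀≤i → centre i (long i n₀≤i)
  where
  centre : ∀ i → LongCentral R M i → CentredAt 0 M (seqβα R i)
  centre i (A , B , e , pal , M≤A , M≤B) rewrite e =
    centredAt-1122 (toDigits (B ++ [ b ])) (toDigits (a ∷ A)) [] [] B A 0 M eW
      (trans (+-identityʳ _) (sym (trans (cong length (toDigits-++ B [ b ])) (length-toDigits-++-pair B one))))
      (comparable-palindrome A B pal) M≤B M≤A
    where
    eW : toDigits (B ++ [ b ]) ++ toDigits (a ∷ A) ≡ toDigits B ++ one ∷ one ∷ two ∷ two ∷ (toDigits A ++ [])
    eW = trans (cong (_++ toDigits (a ∷ A)) (toDigits-++ B [ b ]))
        (trans (++-assoc (toDigits B) (one ∷ one ∷ []) _)
               (cong (λ z → toDigits B ++ one ∷ one ∷ two ∷ two ∷ z) (sym (++-identityʳ (toDigits A)))))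

centred-αTβT-mark : ∀ R → InfinitelyOften R U → InfinitelyOften R V → ∀ M → EventuallyCentredAt (seqαTβT R) 1 M
centred-αTβT-mark R oftenU oftenV M with eventually-longCentral R oftenU oftenV M
... | n₀ , long = n₀ , λ i n₀≤i → centre i (long i n₀≤i)
  where
  centre : ∀ i → LongCentral R M i → CentredAt 1 M (seqαTβT R i)
  centre i (A , B , e , pal , M≤A , M≤B) rewrite e =
    centredAt-2211 (toDigits (reverse (a ∷ A))) (toDigits (reverse (B ++ [ b ]))) [] [] (reverse A) (reverse B) 1 M eW
      (trans (+-comm (1 + length (toDigits (reverse A))) 1)
             (sym (trans (cong length eA) (length-toDigits-++-pair (reverse A) two))))
      (subst (λ z → Comparable z (reverse B)) (sym (reverse-involutive A)) (comparable-sym (comparable-palindrome A B pal)))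
      (subst (M ≤_) (sym (length-reverse A)) M≤A) (subst (M ≤_) (sym (length-reverse B)) M≤B)
    where
    eA : toDigits (reverse (a ∷ A)) ≡ toDigits (reverse A) ++ two ∷ two ∷ []
    eA = trans (cong toDigits (unfold-reverse a A)) (toDigits-++ (reverse A) [ a ])
    eW : toDigits (reverse (a ∷ A)) ++ toDigits (reverse (B ++ [ b ]))
           ≡ toDigits (reverse A) ++ two ∷ two ∷ one ∷ one ∷ (toDigits (reverse B) ++ [])
    eW = trans (cong₂ _++_ eA (cong toDigits (reverse-++ B [ b ])))
        (trans (++-assoc (toDigits (reverse A)) (two ∷ two ∷ []) _)
               (cong (λ z → toDigits (reverse A) ++ two ∷ two ∷ one ∷ one ∷ z) (sym (++-identityʳ _))))

centredAt-ba : ∀ (Q : List Digit) (W₁ X Y W₂ : Word) M → Comparable (reverse X) Y → M ≤ length X → M ≤ length Y →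
  CentredAt (2 + length (toDigits (Y ++ W₂))) M (toDigits ((W₁ ++ X) ++ b ∷ a ∷ (Y ++ W₂)) , Q)
centredAt-ba Q W₁ X Y W₂ M comparable M≤X M≤Y =
  centredAt-1122 _ Q (toDigits W₁) (toDigits W₂ ++ Q) X Y _ M eW position comparable M≤X M≤Y
  where
  open ≡-Reasoning
  eW : toDigits ((W₁ ++ X) ++ b ∷ a ∷ (Y ++ W₂)) ++ Q
         ≡ (toDigits W₁ ++ toDigits X) ++ one ∷ one ∷ two ∷ two ∷ (toDigits Y ++ (toDigits W₂ ++ Q))
  eW = begin
    toDigits ((W₁ ++ X) ++ b ∷ a ∷ (Y ++ W₂)) ++ Q
      ≡⟨ cong (_++ Q) (toDigits-++ (W₁ ++ X) (b ∷ a ∷ (Y ++ W₂))) ⟩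
    (toDigits (W₁ ++ X) ++ one ∷ one ∷ two ∷ two ∷ toDigits (Y ++ W₂)) ++ Q
      ≡⟨ ++-assoc (toDigits (W₁ ++ X)) _ Q ⟩
    toDigits (W₁ ++ X) ++ one ∷ one ∷ two ∷ two ∷ (toDigits (Y ++ W₂) ++ Q)
      ≡⟨ cong₂ (λ x y → x ++ one ∷ one ∷ two ∷ two ∷ (y ++ Q)) (toDigits-++ W₁ X) (toDigits-++ Y W₂) ⟩
    (toDigits W₁ ++ toDigits X) ++ one ∷ one ∷ two ∷ two ∷ ((toDigits Y ++ toDigits W₂) ++ Q)
      ≡⟨ cong (λ z → (toDigits W₁ ++ toDigits X) ++ one ∷ one ∷ two ∷ two ∷ z) (++-assoc (toDigits Y) (toDigits W₂) Q) ⟩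
    (toDigits W₁ ++ toDigits X) ++ one ∷ one ∷ two ∷ two ∷ (toDigits Y ++ (toDigits W₂ ++ Q)) ∎
  position : 2 + length (toDigits W₁ ++ toDigits X) + (2 + length (toDigits (Y ++ W₂)))
               ≡ length (toDigits ((W₁ ++ X) ++ b ∷ a ∷ (Y ++ W₂)))
  position = begin
    2 + length (toDigits W₁ ++ toDigits X) + (2 + length (toDigits (Y ++ W₂)))
      ≡⟨ cong (λ z → 2 + length z + (2 + length (toDigits (Y ++ W₂)))) (sym (toDigits-++ W₁ X)) ⟩
    2 + length (toDigits (W₁ ++ X)) + (2 + length (toDigits (Y ++ W₂)))
      ≡⟨ solve 2 (λ x y → con 2 :+ x :+ (con 2 :+ y) := x :+ (con 4 :+ y)) refl _ (length (toDigits (Y ++ W₂))) ⟩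
    length (toDigits (W₁ ++ X)) + (4 + length (toDigits (Y ++ W₂)))
      ≡⟨ sym (length-++ (toDigits (W₁ ++ X))) ⟩
    length (toDigits (W₁ ++ X) ++ one ∷ one ∷ two ∷ two ∷ toDigits (Y ++ W₂))
      ≡⟨ cong length (sym (toDigits-++ (W₁ ++ X) (b ∷ a ∷ (Y ++ W₂)))) ⟩
    length (toDigits ((W₁ ++ X) ++ b ∷ a ∷ (Y ++ W₂))) ∎
    where open +-*-Solver

centredAt-ab : ∀ (Q : List Digit) (W₁ X Y W₂ : Word) M → Comparable (reverse X) Y → M ≤ length X → M ≤ length Y →
  CentredAt (3 + length (toDigits (Y ++ W₂))) M (toDigits ((W₁ ++ X) ++ a ∷ b ∷ (Y ++ W₂)) , Q)
centredAt-ab Q W₁ X Y W₂ M comparable M≤X M≤Y =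
  centredAt-2211 _ Q (toDigits W₁) (toDigits W₂ ++ Q) X Y _ M eW position comparable M≤X M≤Y
  where
  open ≡-Reasoning
  eW : toDigits ((W₁ ++ X) ++ a ∷ b ∷ (Y ++ W₂)) ++ Q
         ≡ (toDigits W₁ ++ toDigits X) ++ two ∷ two ∷ one ∷ one ∷ (toDigits Y ++ (toDigits W₂ ++ Q))
  eW = begin
    toDigits ((W₁ ++ X) ++ a ∷ b ∷ (Y ++ W₂)) ++ Q
      ≡⟨ cong (_++ Q) (toDigits-++ (W₁ ++ X) (a ∷ b ∷ (Y ++ W₂))) ⟩
    (toDigits (W₁ ++ X) ++ two ∷ two ∷ one ∷ one ∷ toDigits (Y ++ W₂)) ++ Q
      ≡⟨ ++-assoc (toDigits (W₁ ++ X)) _ Q ⟩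
    toDigits (W₁ ++ X) ++ two ∷ two ∷ one ∷ one ∷ (toDigits (Y ++ W₂) ++ Q)
      ≡⟨ cong₂ (λ x y → x ++ two ∷ two ∷ one ∷ one ∷ (y ++ Q)) (toDigits-++ W₁ X) (toDigits-++ Y W₂) ⟩
    (toDigits W₁ ++ toDigits X) ++ two ∷ two ∷ one ∷ one ∷ ((toDigits Y ++ toDigits W₂) ++ Q)
      ≡⟨ cong (λ z → (toDigits W₁ ++ toDigits X) ++ two ∷ two ∷ one ∷ one ∷ z) (++-assoc (toDigits Y) (toDigits W₂) Q) ⟩
    (toDigits W₁ ++ toDigits X) ++ two ∷ two ∷ one ∷ one ∷ (toDigits Y ++ (toDigits W₂ ++ Q)) ∎
  position : 1 + length (toDigits W₁ ++ toDigits X) + (3 + length (toDigits (Y ++ W₂)))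
               ≡ length (toDigits ((W₁ ++ X) ++ a ∷ b ∷ (Y ++ W₂)))
  position = begin
    1 + length (toDigits W₁ ++ toDigits X) + (3 + length (toDigits (Y ++ W₂)))
      ≡⟨ cong (λ z → 1 + length z + (3 + length (toDigits (Y ++ W₂)))) (sym (toDigits-++ W₁ X)) ⟩
    1 + length (toDigits (W₁ ++ X)) + (3 + length (toDigits (Y ++ W₂)))
      ≡⟨ solve 2 (λ x y → con 1 :+ x :+ (con 3 :+ y) := x :+ (con 4 :+ y)) refl _ (length (toDigits (Y ++ W₂))) ⟩
    length (toDigits (W₁ ++ X)) + (4 + length (toDigits (Y ++ W₂)))
      ≡⟨ sym (length-++ (toDigits (W₁ ++ X))) ⟩
    length (toDigits (W₁ ++ X) ++ two ∷ two ∷ one ∷ one ∷ toDigits (Y ++ W₂))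
      ≡⟨ cong length (sym (toDigits-++ (W₁ ++ X) (a ∷ b ∷ (Y ++ W₂)))) ⟩
    length (toDigits ((W₁ ++ X) ++ a ∷ b ∷ (Y ++ W₂))) ∎
    where open +-*-Solver

α-ends-with-β : ∀ R {n u₀} → n ≤ u₀ → R u₀ ≡ U → ∀ {m} → suc u₀ ≤ m → ∃ λ S → α R m ≡ S ++ β R n
α-ends-with-β R {n} {u₀} n≤u₀ Ru₀≡U = induction-from (suc u₀) base step
  where
  base : ∃ λ S → α R (suc u₀) ≡ S ++ β R n
  base rewrite Ru₀≡U with β-suffix R n≤u₀
  ... | Z , e = α R u₀ ++ Z , trans (cong (α R u₀ ++_) e) (sym (++-assoc (α R u₀) Z (β R n)))
  step : ∀ m → suc u₀ ≤ m → (∃ λ S → α R m ≡ S ++ β R n) → ∃ λ S → α R (suc m) ≡ S ++ β R n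
  step m u₀<m (S , e) with R m | β-suffix R (≤-trans n≤u₀ (≤-trans (n≤1+n u₀) u₀<m))
  ... | U | Z , e′ = α R m ++ Z , trans (cong (α R m ++_) e′) (sym (++-assoc (α R m) Z (β R n)))
  ... | V | _      = S , e

β-starts-with-α : ∀ R {n v₁} → n ≤ v₁ → R v₁ ≡ V → ∀ {m} → suc v₁ ≤ m → ∃ λ T → β R m ≡ α R n ++ T
β-starts-with-α R {n} {v₁} n≤v₁ Rv₁≡V = induction-from (suc v₁) base step
  where
  base : ∃ λ T → β R (suc v₁) ≡ α R n ++ T
  base rewrite Rv₁≡V with α-prefix R n≤v₁
  ... | Z , e = Z ++ β R v₁ , trans (cong (_++ β R v₁) e) (++-assoc (α R n) Z (β R v₁))
  step : ∀ m → suc v₁ ≤ m → (∃ λ T → β R m ≡ α R n ++ T) → ∃ λ T → β R (suc m) ≡ α R n ++ T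
  step m v₁<m (T , e) with R m | α-prefix R (≤-trans n≤v₁ (≤-trans (n≤1+n v₁) v₁<m))
  ... | V | Z , e′ = Z ++ β R m , trans (cong (_++ β R m) e′) (++-assoc (α R n) Z (β R m))
  ... | U | _      = T , e

≤length-toDigits-++ : ∀ {N} (X Y : Word) → N ≤ length X → N ≤ length (toDigits (X ++ Y))
≤length-toDigits-++ X Y N≤X = ≤length-toDigits (X ++ Y) (≤-trans N≤X (length-++ˡ X refl))

-- After a Ū at u₀ ≥ n, every α ends with βₙ = B b; after a later V̄, every β starts with
-- αₙ = a A.  The next V̄ glues them into a factor B b a A of all later β, at a fixed
-- distance from their end.
centred-βα-far : ∀ R → InfinitelyOften R U → InfinitelyOften R V → ∀ N M →
  ∃ λ p → (N ≤ p) × EventuallyCentredAt (seqβα R) p M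
centred-βα-far R oftenU oftenV N M with eventually-longCentral R oftenU oftenV (N + M)
... | n , long with long n ≤-refl
... | A , B , e , pal , NM≤A , NM≤B with oftenU n
... | u₀ , n≤u₀ , Ru₀≡U with oftenV (suc u₀)
... | v₁ , u₀<v₁ , Rv₁≡V with oftenV (suc v₁)
... | v₂ , v₁<v₂ , Rv₂≡V
  with α-ends-with-β R n≤u₀ Ru₀≡U (≤-trans u₀<v₁ (≤-trans (n≤1+n v₁) v₁<v₂))
     | β-starts-with-α R (≤-trans n≤u₀ (≤-trans (n≤1+n u₀) u₀<v₁)) Rv₁≡V v₁<v₂
... | S , eS | T , eT =
  2 + length (toDigits (A ++ T)) , ≤-trans (≤length-toDigits-++ A T (≤-trans (m≤m+n N M) NM≤A)) (m≤n+m _ 2) ,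
  suc v₂ , centre
  where
  glued : β R (suc v₂) ≡ (S ++ (B ++ [ b ])) ++ ((a ∷ A) ++ T)
  glued rewrite Rv₂≡V = cong₂ _++_ (trans eS (cong (λ z → S ++ proj₂ z) e)) (trans eT (cong (λ z → proj₁ z ++ T) e))
  centre : ∀ i → suc v₂ ≤ i → CentredAt (2 + length (toDigits (A ++ T))) M (seqβα R i)
  centre i v₂<i with β-suffix R v₂<i
  ... | Z , eZ =
    subst (λ z → CentredAt _ M (toDigits z , toDigits (α R i))) (sym (trans eZ (trans (cong (Z ++_) glued) reassociate)))
    (centredAt-ba (toDigits (α R i)) (Z ++ S) B A T M (comparable-palindrome A B pal)
      (≤-trans (m≤n+m M N) NM≤B) (≤-trans (m≤n+m M N) NM≤A))
    where
    reassociate : Z ++ ((S ++ (B ++ [ b ])) ++ ((a ∷ A) ++ T)) ≡ ((Z ++ S) ++ B) ++ b ∷ a ∷ (A ++ T)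
    reassociate = begin
      Z ++ ((S ++ (B ++ [ b ])) ++ (a ∷ A ++ T))   ≡⟨ cong (Z ++_) (++-assoc S (B ++ [ b ]) _) ⟩
      Z ++ (S ++ ((B ++ [ b ]) ++ (a ∷ A ++ T)))   ≡⟨ cong (λ z → Z ++ (S ++ z)) (++-assoc B [ b ] _) ⟩
      Z ++ (S ++ (B ++ b ∷ a ∷ (A ++ T)))          ≡⟨ sym (++-assoc Z S _) ⟩
      (Z ++ S) ++ (B ++ b ∷ a ∷ (A ++ T))          ≡⟨ sym (++-assoc (Z ++ S) B _) ⟩
      ((Z ++ S) ++ B) ++ b ∷ a ∷ (A ++ T)          ∎
      where open ≡-Reasoning

centred-αTβT-far : ∀ R → InfinitelyOften R U → InfinitelyOften R V → ∀ N M →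
  ∃ λ p → (N ≤ p) × EventuallyCentredAt (seqαTβT R) p M
centred-αTβT-far R oftenU oftenV N M with eventually-longCentral R oftenU oftenV (N + M)
... | n , long with long n ≤-refl
... | A , B , e , pal , NM≤A , NM≤B with oftenU n
... | u₀ , n≤u₀ , Ru₀≡U with oftenV (suc u₀)
... | v₁ , u₀<v₁ , Rv₁≡V with oftenU (suc v₁)
... | u₁ , v₁<u₁ , Ru₁≡U
  with α-ends-with-β R n≤u₀ Ru₀≡U (≤-trans u₀<v₁ (≤-trans (n≤1+n v₁) v₁<u₁))
     | β-starts-with-α R (≤-trans n≤u₀ (≤-trans (n≤1+n u₀) u₀<v₁)) Rv₁≡V v₁<u₁
... | S , eS | T , eT =
  3 + length (toDigits (reverse B ++ reverse S)) ,
  ≤-trans (≤length-toDigits-++ (reverse B) (reverse S) (subst (N ≤_) (sym (length-reverse B)) (≤-trans (m≤m+n N M) NM≤B)))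
          (m≤n+m _ 3) ,
  suc u₁ , centre
  where
  glued : α R (suc u₁) ≡ (S ++ (B ++ [ b ])) ++ ((a ∷ A) ++ T)
  glued rewrite Ru₁≡U = cong₂ _++_ (trans eS (cong (λ z → S ++ proj₂ z) e)) (trans eT (cong (λ z → proj₁ z ++ T) e))
  centre : ∀ i → suc u₁ ≤ i → CentredAt (3 + length (toDigits (reverse B ++ reverse S))) M (seqαTβT R i)
  centre i u₁<i with α-prefix R u₁<i
  ... | Z , eZ = subst (λ z → CentredAt _ M (toDigits z , toDigits (reverse (β R i))))
      (sym (trans (cong reverse (trans eZ (cong (_++ Z) glued))) reassociate))
    (centredAt-ab (toDigits (reverse (β R i))) (reverse Z ++ reverse T) (reverse A) (reverse B) (reverse S) M
      (subst (λ z → Comparable z (reverse B)) (sym (reverse-involutive A)) (comparable-sym (comparable-palindrome A B pal)))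
      (subst (M ≤_) (sym (length-reverse A)) (≤-trans (m≤n+m M N) NM≤A))
      (subst (M ≤_) (sym (length-reverse B)) (≤-trans (m≤n+m M N) NM≤B)))
    where
    open ≡-Reasoning
    reassociate : reverse (((S ++ (B ++ [ b ])) ++ ((a ∷ A) ++ T)) ++ Z)
                ≡ ((reverse Z ++ reverse T) ++ reverse A) ++ a ∷ b ∷ (reverse B ++ reverse S)
    reassociate = begin
      reverse (((S ++ (B ++ [ b ])) ++ ((a ∷ A) ++ T)) ++ Z)
        ≡⟨ reverse-++ ((S ++ (B ++ [ b ])) ++ ((a ∷ A) ++ T)) Z ⟩
      reverse Z ++ reverse ((S ++ (B ++ [ b ])) ++ ((a ∷ A) ++ T))
        ≡⟨ cong (reverse Z ++_) (reverse-++ (S ++ (B ++ [ b ])) ((a ∷ A) ++ T)) ⟩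
      reverse Z ++ (reverse (a ∷ (A ++ T)) ++ reverse (S ++ (B ++ [ b ])))
        ≡⟨ cong₂ (λ x y → reverse Z ++ (x ++ y))
                 (trans (unfold-reverse a (A ++ T)) (cong (_++ [ a ]) (reverse-++ A T)))
                 (trans (reverse-++ S (B ++ [ b ])) (cong (_++ reverse S) (reverse-++ B [ b ]))) ⟩
      reverse Z ++ (((reverse T ++ reverse A) ++ [ a ]) ++ ((b ∷ reverse B) ++ reverse S))
        ≡⟨ cong (reverse Z ++_) (++-assoc (reverse T ++ reverse A) [ a ] _) ⟩
      reverse Z ++ ((reverse T ++ reverse A) ++ a ∷ b ∷ (reverse B ++ reverse S))
        ≡⟨ sym (++-assoc (reverse Z) (reverse T ++ reverse A) _) ⟩
      (reverse Z ++ (reverse T ++ reverse A)) ++ a ∷ b ∷ (reverse B ++ reverse S)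
        ≡⟨ cong (_++ a ∷ b ∷ (reverse B ++ reverse S)) (sym (++-assoc (reverse Z) (reverse T) (reverse A))) ⟩
      ((reverse Z ++ reverse T) ++ reverse A) ++ a ∷ b ∷ (reverse B ++ reverse S) ∎

wellFlankedDigits-βα : ∀ R i → WellFlankedDigits (proj₁ (seqβα R i) ++ proj₂ (seqβα R i))
wellFlankedDigits-βα R i = subst WellFlankedDigits (toDigits-++ (β R i) (α R i))
  (wellFlankedDigits-toDigits _ (wellFlanked-βα R i))

wellFlankedDigits-αTβT : ∀ R i → WellFlankedDigits (proj₁ (seqαTβT R i) ++ proj₂ (seqαTβT R i))
wellFlankedDigits-αTβT R i =
  subst WellFlankedDigits
    (trans (cong toDigits (reverse-++ (β R i) (α R i))) (toDigits-++ (reverse (α R i)) (reverse (β R i))))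
    (wellFlankedDigits-toDigits _ (wellFlanked-reverse _ (wellFlanked-βα R i)))

lagrange-markov-3 : ∀ (w : ℕ → Marked) → (∀ i → WellFlankedDigits (proj₁ (w i) ++ proj₂ (w i))) →
  ∀ q → (∀ M → EventuallyCentredAt w q M) → (∀ N M → ∃ λ p → (N ≤ p) × EventuallyCentredAt w p M) →
  ∀ ω → ConvergesTo w ω → LagrangeValueIs3 ω × MarkovValueIs3 ω
lagrange-markov-3 w flanked q centredNear centredFar ω conv = (lagrange≤ , lagrange≥) , (markov≤ , markov≥)
  where
  markov≤ : ∀ n → LamLe (shift n ω) three
  markov≤ = lamLe-3 w ω conv flanked
  lagrange≤ : ∀ ε → 0ℚᵘ ℚ.< ε → ∃ λ N → ∀ n → N ≤ n → LamLe (shift (+ n) ω) (three ℚ.+ ε)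
  lagrange≤ ε ε>0 = 0 , λ n _ → lamLe-mono {shift (+ n) ω} (p≤p+ε three ε>0) (markov≤ (+ n))
  markov≥ : ∀ ε → 0ℚᵘ ℚ.< ε → ∃ λ n → LamGe (shift n ω) (three ℚ.- ε)
  markov≥ ε ε>0 with archimedean ε ε>0
  ... | N , 1/N≤ε = + q , lamGe-3-ε w ω conv q ε N 1/N≤ε (centredNear (2 + N))
  lagrange≥ : ∀ ε → 0ℚᵘ ℚ.< ε → ∀ N₀ → ∃ λ n → N₀ ≤ n × LamGe (shift (+ n) ω) (three ℚ.- ε)
  lagrange≥ ε ε>0 N₀ with archimedean ε ε>0
  ... | N , 1/N≤ε with centredFar N₀ (2 + N)
  ... | p , N₀≤p , centred = p , N₀≤p , lamGe-3-ε w ω conv p ε N 1/N≤ε centred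

proposition2p10 : (R : ℕ → Move) → InfinitelyOften R U → InfinitelyOften R V →
    ConvergesWithLM3 (seqβα R) × ConvergesWithLM3 (seqαTβT R)
proposition2p10 R oftenU oftenV =
    ( converges-βα R oftenU oftenV
    , lagrange-markov-3 (seqβα R) (wellFlankedDigits-βα R)
        0 (centred-βα-mark R oftenU oftenV) (centred-βα-far R oftenU oftenV))
  , ( converges-αTβT R oftenU oftenV
    , lagrange-markov-3 (seqαTβT R) (wellFlankedDigits-αTβT R)
        1 (centred-αTβT-mark R oftenU oftenV) (centred-αTβT-far R oftenU oftenV))
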